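{- Let $\sigma$ be the morphism on $\{0,1,2\}^*$ defined by $\sigma(0)=01$, $\sigma(1)=12$, $\sigma(2)=20$, and let $\mathbf{t}=\sigma^{\infty}(0)=t_0t_1t_2\cdots$ be its fixed point starting with $0$. Let $n\geq1$, let $u$ be a factor of $\mathbf{t}$ of length $n$, and let $W(n)$ be the word defined in the context. For $j\geq0$ let $g_n(j)=\mathrm{DS}(t_jt_{j+1}\cdots t_{j+n-1})$, and for each $i$ with $t_i\cdots t_{i+n-1}=u$ let $r_i(u)=\min\{j>i: g_n(j)>\mathrm{DS}(u)\}$. If $\mathrm{DS}(u)\neq \mathrm{DS}(W(n))$, then for every such $i$, $r_i(u)$ is finite and $g_n(r_i(u))-\mathrm{DS}(u)\in\{1,2\}$; moreover, if $g_n(r_i(u))-\mathrm{DS}(u)=2$, then $g_n(r_i(u)-1)=\mathrm{DS}(u)$.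
   Context: $\mathrm{DS}(w)$ is the sum of the letters of $w$. Letters $d_k$ ($k\geq -1$): $d_k=0$ if $k\equiv 3,4\pmod 6$, $d_k=1$ if $k\equiv1,2\pmod6$, $d_k=2$ if $k\equiv 0,5\pmod 6$. Words $W(n)$: $W(1)=2$. For $n\geq2$, let $k\geq1$ with $2^k\leq n<2^{k+1}$ and write $n-2^k=\sum_{j=0}^{k-1}m_j2^j$ with $m_j\in\{0,1\}$. Let $\delta=\varepsilon$ if $m_0=0$ and $\delta=1$ if $m_0=1$; $L=\lfloor (k-1)/2\rfloor$, $R=\lceil (k-1)/2\rceil$. Define $W_L(n)=\delta\,2\,\prod_{i=1}^{L}\sigma^{2i+m_{2i}}(d_{2i+m_{2i}})$ (concatenation in increasing order of $i$) and $W_R(n)=\big(\prod_{i=R}^{1}\sigma^{2i-1+m_{2i-1}}(d_{2i-1+m_{2i-1}})\big)\,2$ (concatenation in decreasing order of $i$ from $R$ to $1$), empty products being the empty word; $W(n)=W_L(n)W_R(n)$. -}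

module Defs where

open import Data.Nat using (ℕ; zero; suc; _+_; _*_; _∸_; _^_; _/_; _%_)
open import Data.Nat.Logarithm using (⌊log₂_⌋)
open import Data.Nat.ListAction using (sum)
open import Data.List using (List; []; _∷_; _++_; concatMap; concat; map; length; upTo; reverse)
open import Function using (_∘_)

-- Letters 0,1,2 are represented by the natural numbers 0,1,2.

σ : ℕ → List ℕ
σ 0 = 0 ∷ 1 ∷ []
σ 1 = 1 ∷ 2 ∷ []
σ _ = 2 ∷ 0 ∷ []

σ* : List ℕ → List ℕ
σ* = concatMap σ

σ^ : ℕ → List ℕ → List ℕ
σ^ zero    w = w
σ^ (suc k) w = σ* (σ^ k w)

-- j-th letter of a word (default 0 when out of range; never used out of range below).
nth : List ℕ → ℕ → ℕ
nth []       _       = 0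
nth (a ∷ w) zero    = a
nth (a ∷ w) (suc j) = nth w j

-- The fixed point t = σ^∞(0): σ^k(0) is a prefix of t of length 2^k, so
-- t_j is the j-th letter of σ^(j+1)(0) (which has length 2^(j+1) > j).
t : ℕ → ℕ
t j = nth (σ^ (suc j) (0 ∷ [])) j

factor : ℕ → ℕ → List ℕ
factor i zero    = []
factor i (suc n) = t i ∷ factor (suc i) n

DS : List ℕ → ℕ
DS = sum

g : ℕ → ℕ → ℕ
g n j = DS (factor j n)

-- Letters d_k (only needed for k ≥ 1 here).
d : ℕ → ℕ
d k with k % 6
... | 0 = 2
... | 1 = 1
... | 2 = 1
... | 3 = 0
... | 4 = 0
... | _ = 2

blk : ℕ → List ℕ
blk e = σ^ e (d e ∷ [])

bit : ℕ → ℕ → ℕ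
bit x zero    = x % 2
bit x (suc j) = bit (x / 2) j

-- The word W(n).  For n ≥ 2, k = ⌊log₂ n⌋ (so 2^k ≤ n < 2^(k+1), k ≥ 1),
-- m_j = j-th binary digit of n - 2^k, L = ⌊(k-1)/2⌋, R = ⌈(k-1)/2⌉ = ⌊k/2⌋.
-- (For n = 0 the value is irrelevant.)
W : ℕ → List ℕ
W zero          = []
W (suc zero)    = 2 ∷ []
W n@(suc (suc _)) = WL ++ WR
  where
  k  = ⌊log₂ n ⌋
  r  = n ∸ 2 ^ k
  m  = bit r
  δ  : List ℕ
  δ  with m 0
  ... | 0 = []
  ... | _ = 1 ∷ []
  L  = (k ∸ 1) / 2
  R  = k / 2
  WL = δ ++ (2 ∷ concat (map (λ i → blk (2 * i + m (2 * i))) (map suc (upTo L))))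
  WR = concat (map (λ i → blk (2 * i ∸ 1 + m (2 * i ∸ 1))) (reverse (map suc (upTo R)))) ++ (2 ∷ [])

-- Let k = ⌊log₂ n⌋.  The theorem follows from four facts about g_n:
--   (1) g_n(j) ≤ n + k + 1 for every j                          (g-upper);
--   (2) g_n(j) = n + k + 1 for arbitrarily large j              (g-peak);
--   (3) DS(W(n)) = n + k + 1                                    (DS-W);
--   (4) g_n(j + 1) ≤ g_n(j) + 2, as a window slides by one      (g-step).
-- For DS(u) = g_n(i) ≠ DS(W(n)), (1) and (3) give DS(u) < n + k + 1, (2)
-- gives a later window exceeding DS(u), and by (4) the first one, at r,
-- overshoots by 1 or 2, and by 2 only if g_n(r - 1) = DS(u) (first-passage).
--
-- (1) and (2) are discrepancy estimates for the centred letters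
-- h(x) = x - 1.  As σ(x) = x · rot x and h(x) + h(rot x) = -h(rot² x),
-- halving a window of τ_c = rot^c ∘ t yields minus a window of τ_{c+2} of
-- about half the length, plus a boundary term (Halving).  Along these
-- halvings (class-induction) we prove bounds refined by the boundary letters
-- and by the class of n (bounded), and that a list of extremal
-- configurations is realised infinitely often (realisable); the
-- compatibility of the finite tables with halving is checked by computation.
-- (3) is a direct count: DS(σ^e(d_e)) = 2^e + 1, and W(n) has one such
-- block for every exponent e + m_e with 1 ≤ e < k, summed by binary expansion.
module Submission where

open import Defs
open import Data.Nat using (ℕ; zero; suc; _+_; _*_; _∸_; _^_; _≤_; _<_; _≥_; z≤n; s≤s; _≡ᵇ_; _≤ᵇ_; _/_; _%_; ⌊_/2⌋; >-nonZero)
open import Data.Nat.Properties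
open import Data.Nat.Induction using (<-rec)
open import Data.Nat.Logarithm using (⌊log₂_⌋; ⌊log₂⌊n/2⌋⌋≡⌊log₂n⌋∸1; ⌊log₂⌋-mono-≤)
open import Data.Nat.DivMod using (m≡m%n+[m/n]*n; m%n<n; [m+kn]%n≡m%n; m<n*o⇒m/o<n; m/n≡1+[m∸n]/n)
open import Data.Nat.ListAction using (sum)
open import Data.Nat.ListAction.Properties using (sum-++; sum-↭)
open import Data.List using (List; []; _∷_; _++_; length; concat; map; upTo; reverse)
open import Data.Bool.ListAction using (any; all)
open import Data.List.Membership.Propositional using (_∈_; find)
open import Data.List.Relation.Unary.Any using (here)
open import Data.List.Relation.Unary.Any.Properties using (any⁻)
open import Data.List.Relation.Unary.All using (All; []; _∷_; lookup)
open import Data.List.Relation.Unary.All.Properties using (++⁺; all⁺)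
open import Data.List.Properties using (concatMap-++; length-++; upTo-∷ʳ; map-++; map-∘; reverse-map)
open import Data.List.Relation.Binary.Permutation.Propositional.Properties using (↭-reverse)
open import Data.Product using (Σ; ∃; _×_; _,_; proj₁; proj₂)
open import Data.Sum using (_⊎_; inj₁; inj₂)
open import Data.Integer using (ℤ; +_)
  renaming (_+_ to _+ᶻ_; _-_ to _-ᶻ_; -_ to -ᶻ_; _≤_ to _≤ᶻ_; _≤ᵇ_ to _≤ᵇᶻ_)
import Data.Integer.Properties as ℤ
open import Data.Integer.Literals using (negative)
open import Agda.Builtin.FromNeg using (Negative)
open import Data.Integer.Tactic.RingSolver using (solve-∀)
open import Data.Nat.Tactic.RingSolver using () renaming (solve-∀ to solve-∀ℕ)
open import Data.Bool using (Bool; true; false; T; if_then_else_; not; _∧_; _∨_)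
open import Data.Bool.Properties using (T-∧; T-∨)
import Data.Bool as Bool
open import Function using (Equivalence)
open import Relation.Binary.PropositionalEquality
open import Data.Unit using (tt)
open import Relation.Nullary using (yes; no; contradiction)
open import Relation.Nullary.Decidable using (⌊_⌋; toWitness)

instance
  ℤ-negative : Negative ℤ
  ℤ-negative = negative

-- The cyclic successor of a letter: σ(x) = x · rot x on letters x ≤ 2.
rot : ℕ → ℕ
rot 0 = 1
rot 1 = 2
rot _ = 0

rot≤2 : ∀ x → rot x ≤ 2
rot≤2 0 = s≤s z≤n
rot≤2 1 = s≤s (s≤s z≤n)
rot≤2 (suc (suc x)) = z≤n

rot³ : ∀ x → x ≤ 2 → rot (rot (rot x)) ≡ x
rot³ 0 _ = refl
rot³ 1 _ = refl
rot³ 2 _ = refl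
rot³ (suc (suc (suc x))) (s≤s (s≤s ()))

σ-letter : ∀ x → x ≤ 2 → σ x ≡ x ∷ rot x ∷ []
σ-letter 0 _ = refl
σ-letter 1 _ = refl
σ-letter 2 _ = refl
σ-letter (suc (suc (suc x))) (s≤s (s≤s ()))

Ternary : List ℕ → Set
Ternary = All (_≤ 2)

σ*-ternary : ∀ w → Ternary (σ* w)
σ*-ternary [] = []
σ*-ternary (x ∷ w) = ++⁺ (σ-ternary x) (σ*-ternary w)
  where
  σ-ternary : ∀ x → Ternary (σ x)
  σ-ternary 0 = z≤n ∷ s≤s z≤n ∷ []
  σ-ternary 1 = s≤s z≤n ∷ s≤s (s≤s z≤n) ∷ []
  σ-ternary (suc (suc x)) = s≤s (s≤s z≤n) ∷ z≤n ∷ []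

σ^-++ : ∀ k u v → σ^ k (u ++ v) ≡ σ^ k u ++ σ^ k v
σ^-++ zero u v = refl
σ^-++ (suc k) u v = trans (cong σ* (σ^-++ k u v)) (concatMap-++ σ (σ^ k u) (σ^ k v))

σ^-σ* : ∀ k w → σ^ k (σ* w) ≡ σ* (σ^ k w)
σ^-σ* zero w = refl
σ^-σ* (suc k) w = cong σ* (σ^-σ* k w)

length-σ* : ∀ w → length (σ* w) ≡ length w + length w
length-σ* [] = refl
length-σ* (x ∷ w) = begin
  length (σ x ++ σ* w)          ≡⟨ length-++ (σ x) ⟩
  length (σ x) + length (σ* w)  ≡⟨ cong₂ _+_ (length-σ x) (length-σ* w) ⟩
  suc (suc (length w + length w)) ≡⟨ cong suc (sym (+-suc (length w) (length w))) ⟩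
  suc (length w + suc (length w)) ∎
  where
  open ≡-Reasoning
  length-σ : ∀ x → length (σ x) ≡ 2
  length-σ 0 = refl
  length-σ 1 = refl
  length-σ (suc (suc x)) = refl

-- The block σ^k(a); the prefix of length 2^k of t is block k 0.
block : ℕ → ℕ → List ℕ
block k a = σ^ k (a ∷ [])

block-suc : ∀ k a → a ≤ 2 → block (suc k) a ≡ block k a ++ block k (rot a)
block-suc k a a≤2 = begin
  σ* (σ^ k (a ∷ []))                ≡⟨ sym (σ^-σ* k (a ∷ [])) ⟩
  σ^ k (σ a ++ [])                  ≡⟨ cong (λ w → σ^ k (w ++ [])) (σ-letter a a≤2) ⟩
  σ^ k ((a ∷ []) ++ (rot a ∷ []))   ≡⟨ σ^-++ k (a ∷ []) (rot a ∷ []) ⟩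
  block k a ++ block k (rot a)      ∎
  where open ≡-Reasoning

2^-suc : ∀ k → 2 ^ suc k ≡ 2 ^ k + 2 ^ k
2^-suc k = cong (λ z → 2 ^ k + z) (+-identityʳ (2 ^ k))

length-block : ∀ k a → length (block k a) ≡ 2 ^ k
length-block zero a = refl
length-block (suc k) a =
  trans (length-σ* (block k a)) (trans (cong₂ _+_ (length-block k a) (length-block k a)) (sym (2^-suc k)))

block-ternary : ∀ k → Ternary (block k 0)
block-ternary zero = z≤n ∷ []
block-ternary (suc k) = σ*-ternary (block k 0)

nth-ternary : ∀ {w} j → Ternary w → nth w j ≤ 2
nth-ternary j [] = z≤n
nth-ternary zero (x≤2 ∷ _) = x≤2
nth-ternary (suc j) (_ ∷ w) = nth-ternary j w

nth-++ : ∀ u v j → j < length u → nth (u ++ v) j ≡ nth u j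
nth-++ (x ∷ u) v zero _ = refl
nth-++ (x ∷ u) v (suc j) (s≤s j<) = nth-++ u v j j<

nth-σ*-even : ∀ {w} j → Ternary w → j < length w → nth (σ* w) (j + j) ≡ nth w j
nth-σ*-even {x ∷ w} zero (x≤2 ∷ _) _ rewrite σ-letter x x≤2 = refl
nth-σ*-even {x ∷ w} (suc j) (x≤2 ∷ tw) (s≤s j<) rewrite σ-letter x x≤2 | +-suc j j = nth-σ*-even j tw j<

nth-σ*-odd : ∀ {w} j → Ternary w → j < length w → nth (σ* w) (suc (j + j)) ≡ rot (nth w j)
nth-σ*-odd {x ∷ w} zero (x≤2 ∷ _) _ rewrite σ-letter x x≤2 = refl
nth-σ*-odd {x ∷ w} (suc j) (x≤2 ∷ tw) (s≤s j<) rewrite σ-letter x x≤2 | +-suc j j = nth-σ*-odd j tw j<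

block-stable : ∀ d k j → j < 2 ^ k → nth (block (d + k) 0) j ≡ nth (block k 0) j
block-stable zero k j j< = refl
block-stable (suc d) k j j< = trans one-step (block-stable d k j j<)
  where
  j<2^dk : j < 2 ^ (d + k)
  j<2^dk = ≤-trans j< (^-monoʳ-≤ 2 (m≤n+m k d))
  one-step : nth (block (suc (d + k)) 0) j ≡ nth (block (d + k) 0) j
  one-step rewrite block-suc (d + k) 0 z≤n =
    nth-++ (block (d + k) 0) _ j (subst (j <_) (sym (length-block (d + k) 0)) j<2^dk)

j<2^j : ∀ j → j < 2 ^ j
j<2^j zero = s≤s z≤n
j<2^j (suc j) = subst (suc (suc j) ≤_) (sym (2^-suc j))
  (≤-trans (≤-reflexive (sym (+-comm (suc j) 1))) (+-mono-≤ (j<2^j j) (≤-trans (s≤s z≤n) (j<2^j j))))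

t-from-block : ∀ k j → j < 2 ^ k → nth (block k 0) j ≡ t j
t-from-block k j j< with ≤-total k (suc j)
... | inj₁ k≤ = trans (sym (block-stable (suc j ∸ k) k j j<)) (cong (λ e → nth (block e 0) j) (m∸n+n≡m k≤))
... | inj₂ k≥ = trans (cong (λ e → nth (block e 0) j) (sym (m∸n+n≡m k≥)))
                      (block-stable (k ∸ suc j) (suc j) j (<-trans (j<2^j j) (^-monoʳ-< 2 (s≤s (s≤s z≤n)) (n<1+n j))))

t≤2 : ∀ j → t j ≤ 2
t≤2 j = nth-ternary j (block-ternary (suc j))

j<2^[j+1] : ∀ j → j < 2 ^ suc j
j<2^[j+1] j = <-trans (n<1+n j) (j<2^j (suc j))

2j+1<2^[j+2] : ∀ j → suc (j + j) < 2 ^ suc (suc j)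
2j+1<2^[j+2] j = subst (suc (j + j) <_) (sym (2^-suc (suc j)))
  (subst (_≤ 2 ^ suc j + 2 ^ suc j) (cong suc (+-suc j j)) (+-mono-≤ (j<2^[j+1] j) (j<2^[j+1] j)))

t-via-σ* : ∀ j i → i ≤ 1 → t (i + (j + j)) ≡ nth (σ* (block (suc j) 0)) (i + (j + j))
t-via-σ* j i i≤1 = sym (t-from-block (suc (suc j)) (i + (j + j))
  (≤-<-trans (+-monoˡ-≤ (j + j) i≤1) (2j+1<2^[j+2] j)))

j<length-block : ∀ j → j < length (block (suc j) 0)
j<length-block j = subst (j <_) (sym (length-block (suc j) 0)) (j<2^[j+1] j)

t-even : ∀ j → t (j + j) ≡ t j
t-even j = begin
  t (j + j)                          ≡⟨ t-via-σ* j 0 z≤n ⟩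
  nth (σ* (block (suc j) 0)) (j + j) ≡⟨ nth-σ*-even j (block-ternary (suc j)) (j<length-block j) ⟩
  nth (block (suc j) 0) j            ≡⟨ t-from-block (suc j) j (j<2^[j+1] j) ⟩
  t j                                ∎
  where open ≡-Reasoning

t-odd : ∀ j → t (suc (j + j)) ≡ rot (t j)
t-odd j = begin
  t (suc (j + j))                          ≡⟨ t-via-σ* j 1 ≤-refl ⟩
  nth (σ* (block (suc j) 0)) (suc (j + j)) ≡⟨ nth-σ*-odd j (block-ternary (suc j)) (j<length-block j) ⟩
  rot (nth (block (suc j) 0) j)            ≡⟨ cong rot (t-from-block (suc j) j (j<2^[j+1] j)) ⟩
  rot (t j)                                ∎
  where open ≡-Reasoning

τ : ℕ → ℕ → ℕ
τ zero j = t j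
τ (suc c) j = rot (τ c j)

τ-even : ∀ c j → τ c (j + j) ≡ τ c j
τ-even zero j = t-even j
τ-even (suc c) j = cong rot (τ-even c j)

τ-odd : ∀ c j → τ c (suc (j + j)) ≡ rot (τ c j)
τ-odd zero j = t-odd j
τ-odd (suc c) j = cong rot (τ-odd c j)

τ≤2 : ∀ c j → τ c j ≤ 2
τ≤2 zero j = t≤2 j
τ≤2 (suc c) j = rot≤2 (τ c j)

h : ℕ → ℤ
h 0 = -1
h 1 = + 0
h _ = + 1

h-σ : ∀ x → h x +ᶻ h (rot x) ≡ -ᶻ h (rot (rot x))
h-σ 0 = refl
h-σ 1 = refl
h-σ (suc (suc x)) = refl

h-letter : ∀ x → x ≤ 2 → h x ≡ + x -ᶻ + 1
h-letter 0 _ = refl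
h-letter 1 _ = refl
h-letter 2 _ = refl
h-letter (suc (suc (suc x))) (s≤s (s≤s ()))

P : ℕ → ℕ → ℤ
P c zero = + 0
P c (suc N) = P c N +ᶻ h (τ c N)

V : ℕ → ℕ → ℕ → ℤ
V c a n = P c (a + n) -ᶻ P c a

-- Self-similarity: pairing t_{2j} t_{2j+1} turns a prefix of length 2N of
-- τ c into minus the prefix of length N of τ (c + 2).
P-even : ∀ c N → P c (N + N) ≡ -ᶻ P (suc (suc c)) N
P-even c zero = refl
P-even c (suc N) = begin
  P c (suc N + suc N)                          ≡⟨ cong (P c) (cong suc (+-suc N N)) ⟩
  P c (N + N) +ᶻ h (τ c (N + N)) +ᶻ h (τ c (suc (N + N)))
    ≡⟨ cong₂ (λ u v → u +ᶻ h (τ c (N + N)) +ᶻ h v) (P-even c N) (τ-odd c N) ⟩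
  -ᶻ P c₂ N +ᶻ h (τ c (N + N)) +ᶻ h (rot (τ c N))
    ≡⟨ cong (λ v → -ᶻ P c₂ N +ᶻ h v +ᶻ h (rot (τ c N))) (τ-even c N) ⟩
  -ᶻ P c₂ N +ᶻ h (τ c N) +ᶻ h (rot (τ c N))     ≡⟨ ℤ.+-assoc (-ᶻ P c₂ N) _ _ ⟩
  -ᶻ P c₂ N +ᶻ (h (τ c N) +ᶻ h (rot (τ c N)))   ≡⟨ cong (-ᶻ P c₂ N +ᶻ_) (h-σ (τ c N)) ⟩
  -ᶻ P c₂ N +ᶻ -ᶻ h (τ c₂ N)                   ≡⟨ sym (ℤ.neg-distrib-+ (P c₂ N) _) ⟩
  -ᶻ P c₂ (suc N)                              ∎
  where
  open ≡-Reasoning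
  c₂ = suc (suc c)

P-odd : ∀ c N → P c (suc (N + N)) ≡ -ᶻ P (suc (suc c)) N +ᶻ h (τ c N)
P-odd c N = cong₂ (λ u v → u +ᶻ h v) (P-even c N) (τ-even c N)

V-single : ∀ c a → V c a 1 ≡ h (τ c a)
V-single c a rewrite +-comm a 1 = cancel (P c a) (h (τ c a))
  where
  cancel : ∀ x y → x +ᶻ y -ᶻ x ≡ y
  cancel = solve-∀

pos : Bool → ℕ → ℕ
pos false A = A + A
pos true A = suc (A + A)

rotIf : Bool → ℕ → ℕ
rotIf false x = x
rotIf true x = rot x

hIf : Bool → ℕ → ℤ
hIf false x = + 0
hIf true x = h x

P-pos : ∀ c b A → P c (pos b A) ≡ -ᶻ P (suc (suc c)) A +ᶻ hIf b (τ c A)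
P-pos c false A = trans (P-even c A) (sym (ℤ.+-identityʳ _))
P-pos c true A = P-odd c A

τ-pos : ∀ c b A → τ c (pos b A) ≡ rotIf b (τ c A)
τ-pos c false A = τ-even c A
τ-pos c true A = τ-odd c A

-- The correction term of a halved window with first letter p and end letter q.
boundary : Bool → Bool → ℕ → ℕ → ℤ
boundary b b' p q = hIf b' q -ᶻ hIf b p

record Halving (a n : ℕ) (b b' : Bool) : Set where
  field
    A M : ℕ
    start : a ≡ pos b A
    end : a + n ≡ pos b' (A + M)

module _ {a n b b'} (H : Halving a n b b') (c : ℕ) where
  open Halving H

  halving-V : V c a n ≡ -ᶻ V (suc (suc c)) A M +ᶻ boundary b b' (τ c A) (τ c (A + M))
  halving-V = begin
    P c (a + n) -ᶻ P c a                            ≡⟨ cong₂ (λ x y → P c x -ᶻ P c y) end start ⟩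
    P c (pos b' (A + M)) -ᶻ P c (pos b A)           ≡⟨ cong₂ _-ᶻ_ (P-pos c b' (A + M)) (P-pos c b A) ⟩
    (-ᶻ P c₂ (A + M) +ᶻ hIf b' (τ c (A + M))) -ᶻ (-ᶻ P c₂ A +ᶻ hIf b (τ c A))
                                                     ≡⟨ regroup (P c₂ (A + M)) (P c₂ A) _ _ ⟩
    -ᶻ V c₂ A M +ᶻ boundary b b' (τ c A) (τ c (A + M)) ∎
    where
    open ≡-Reasoning
    c₂ = suc (suc c)
    regroup : ∀ x y u v → (-ᶻ x +ᶻ u) -ᶻ (-ᶻ y +ᶻ v) ≡ -ᶻ (x -ᶻ y) +ᶻ (u -ᶻ v)
    regroup = solve-∀

  halving-first : τ c a ≡ rotIf b (τ c A)
  halving-first rewrite start = τ-pos c b A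

  halving-last : τ c (a + n) ≡ rotIf b' (τ c (A + M))
  halving-last rewrite end = τ-pos c b' (A + M)

halving-EE : ∀ A m → Halving (A + A) (m + m) false false
halving-EE A m = record { A = A ; M = m ; start = refl ; end = eq A m }
  where
  eq : ∀ A m → (A + A) + (m + m) ≡ (A + m) + (A + m)
  eq = solve-∀ℕ

halving-EO : ∀ A m → Halving (A + A) (suc (m + m)) false true
halving-EO A m = record { A = A ; M = m ; start = refl ; end = eq A m }
  where
  eq : ∀ A m → (A + A) + suc (m + m) ≡ suc ((A + m) + (A + m))
  eq = solve-∀ℕ

halving-OE : ∀ A m → Halving (suc (A + A)) (suc (m + m)) true false
halving-OE A m = record { A = A ; M = suc m ; start = refl ; end = eq A m }
  where
  eq : ∀ A m → suc (A + A) + suc (m + m) ≡ (A + suc m) + (A + suc m)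
  eq = solve-∀ℕ

halving-OO : ∀ A m → Halving (suc (A + A)) (m + m) true true
halving-OO A m = record { A = A ; M = m ; start = refl ; end = eq A m }
  where
  eq : ∀ A m → suc (A + A) + (m + m) ≡ suc ((A + m) + (A + m))
  eq = solve-∀ℕ

Level : ℕ → ℕ → Set
Level n k = 2 ^ k ≤ n × n < 2 ^ suc k

data Parity : ℕ → Set where
  even : ∀ m → Parity (m + m)
  odd : ∀ m → Parity (suc (m + m))

parity : ∀ n → Parity n
parity zero = even 0
parity (suc n) with parity n
... | even m = odd m
... | odd m = subst Parity (cong suc (+-suc m m)) (even (suc m))

1≤2^ : ∀ k → 1 ≤ 2 ^ k
1≤2^ k = m^n>0 2 k

half-≤ : ∀ {m x} → m + m ≤ x + x → m ≤ x
half-≤ {m} {x} p with m ≤? x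
... | yes q = q
... | no q = contradiction p (<⇒≱ (+-mono-< (≰⇒> q) (≰⇒> q)))

half-< : ∀ {m x} → m + m < x + x → m < x
half-< {m} {x} p with m <? x
... | yes q = q
... | no q = contradiction p (≤⇒≯ (+-mono-≤ (≮⇒≥ q) (≮⇒≥ q)))

level-1 : ∀ n → Level n 0 → n ≡ 1
level-1 (suc zero) _ = refl
level-1 zero (() , _)
level-1 (suc (suc n)) (_ , s≤s (s≤s ()))

level-even : ∀ m k → Level (m + m) k → Σ ℕ λ k' → k ≡ suc k' × Level m k'
level-even zero k (p , _) = contradiction p (<⇒≱ (1≤2^ k))
level-even (suc m) zero (_ , s≤s (s≤s q)) with subst (_≤ 0) (+-suc m m) q
... | ()
level-even (suc m) (suc k) (p , q) =
  k , refl , half-≤ (subst (_≤ suc m + suc m) (2^-suc k) p) , half-< (subst (suc m + suc m <_) (2^-suc (suc k)) q)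

level-odd : ∀ m k → Level (suc (m + m)) (suc k) → Level m k
level-odd m k (p , q) = half-≤' (subst (_≤ suc (m + m)) (2^-suc k) p) , half-< (<-trans (n<1+n _) (subst (suc (m + m) <_) (2^-suc (suc k)) q))
  where
  half-≤' : ∀ {m x} → x + x ≤ suc (m + m) → x ≤ m
  half-≤' {m} {x} p with x ≤? m
  ... | yes q = q
  ... | no q = contradiction (≤-trans (s≤s (≤-reflexive (sym (+-suc m m)))) (+-mono-≤ (≰⇒> q) (≰⇒> q))) (<⇒≱ (s≤s p))

level-odd-0 : ∀ m → Level (suc (m + m)) 0 → m ≡ 0
level-odd-0 zero _ = refl
level-odd-0 (suc m) (_ , s≤s (s≤s ()))

level-pos : ∀ {n} k → Level n k → 1 ≤ n
level-pos k (p , _) = ≤-trans (1≤2^ k) p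

level-succ-half : ∀ m k → Level (suc (m + m)) (suc k) →
  (suc m ≡ 2 ^ suc k × Level (suc m) (suc k)) ⊎
  (Σ ℕ λ k'' → k ≡ suc k'' × Level (suc m) (suc k'') × 2 ^ suc k'' < suc m)
level-succ-half m k lv with level-odd m k lv
... | (p , q) with suc m ≟ 2 ^ suc k
...   | yes e = inj₁ (e , ≤-reflexive (sym e) , subst (_< 2 ^ suc (suc k)) (sym e)
          (subst (2 ^ suc k <_) (sym (2^-suc (suc k))) (m<m+n (2 ^ suc k) (1≤2^ (suc k)))))
...   | no ne with k
...     | zero = contradiction (≤-antisym q (s≤s p)) ne
...     | suc k'' = inj₂ (k'' , refl , (m≤n⇒m≤1+n p , ≤∧≢⇒< q ne) , s≤s p)

level-exists : ∀ n → 1 ≤ n → Σ ℕ (Level n)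
level-exists (suc zero) _ = 0 , s≤s z≤n , s≤s (s≤s z≤n)
level-exists (suc (suc n)) _ with level-exists (suc n) (s≤s z≤n)
... | k , p , q with suc (suc n) <? 2 ^ suc k
...   | yes lt = k , ≤-trans p (n≤1+n _) , lt
...   | no nlt = suc k , ≤-reflexive e , subst (_< 2 ^ suc (suc k)) e
          (subst (2 ^ suc k <_) (sym (2^-suc (suc k))) (m<m+n (2 ^ suc k) (1≤2^ (suc k))))
  where
  e : 2 ^ suc k ≡ suc (suc n)
  e = ≤-antisym (≮⇒≥ nlt) q

-- The four kinds of window length n of level k that the invariants below
-- distinguish: n = 1, n = 2^k with k ≥ 1, other even n, odd n > 1.
data Class : Set where
  κ1 κpow κeven κodd : Class

isOdd : ℕ → Bool
isOdd zero = false
isOdd (suc n) = not (isOdd n)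

class : ℕ → ℕ → Class
class n zero = κ1
class n (suc k) = if isOdd n then κodd else (if n ≡ᵇ 2 ^ suc k then κpow else κeven)

double : Class → Class
double κ1 = κpow
double κpow = κpow
double κeven = κeven
double κodd = κeven

isOdd-even : ∀ m → isOdd (m + m) ≡ false
isOdd-even zero = refl
isOdd-even (suc m) rewrite +-suc m m | isOdd-even m = refl

≡ᵇ-double : ∀ m x → (m + m ≡ᵇ x + x) ≡ (m ≡ᵇ x)
≡ᵇ-double zero zero = refl
≡ᵇ-double zero (suc x) = refl
≡ᵇ-double (suc m) zero = refl
≡ᵇ-double (suc m) (suc x) rewrite +-suc m m | +-suc x x = ≡ᵇ-double m x

≡ᵇ-refl : ∀ x → (x ≡ᵇ x) ≡ true
≡ᵇ-refl zero = refl
≡ᵇ-refl (suc x) = ≡ᵇ-refl x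

class-even : ∀ m k → Level m k → class (m + m) (suc k) ≡ double (class m k)
class-even m zero lv rewrite level-1 m lv = refl
class-even m (suc k) lv rewrite isOdd-even m | 2^-suc (suc k) | ≡ᵇ-double m (2 ^ suc k)
  with m ≡ᵇ 2 ^ suc k in eq
... | true rewrite ≡ᵇ⇒≡ m (2 ^ suc k) (subst T (sym eq) tt) | 2^-suc k | isOdd-even (2 ^ k) = refl
... | false with isOdd m
...   | true = refl
...   | false = refl

class-odd : ∀ m k → class (suc (m + m)) (suc k) ≡ κodd
class-odd m k rewrite isOdd-even m = refl

class-power : ∀ k → class (2 ^ suc k) (suc k) ≡ κpow
class-power k rewrite 2^-suc k | isOdd-even (2 ^ k) | sym (2^-suc k) | ≡ᵇ-refl (2 ^ suc k) = refl

class-nonpower : ∀ n k → 2 ^ suc k < n → (class n (suc k) ≡ κeven) ⊎ (class n (suc k) ≡ κodd)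
class-nonpower n k lt with isOdd n
... | true = inj₂ refl
... | false with n ≡ᵇ 2 ^ suc k in eq
...   | true = contradiction (≡ᵇ⇒≡ n (2 ^ suc k) (subst T (sym eq) tt)) (≢-sym (<⇒≢ lt))
...   | false = inj₁ refl

Triple : Set
Triple = ℤ × ℤ × ℤ

pick : Triple → ℕ → ℤ
pick (x , _ , _) 0 = x
pick (_ , y , _) 1 = y
pick (_ , _ , z) _ = z

grid : Triple → Triple → Triple → ℕ → ℕ → ℤ
grid r₀ r₁ r₂ 0 q = pick r₀ q
grid r₀ r₁ r₂ 1 q = pick r₁ q
grid r₀ r₁ r₂ _ q = pick r₂ q

-- The refined discrepancy bounds: for a window of class κ with first letter
-- p and end letter q, the centred sum V satisfies
--   lo κ p q - (k + 1) ≤ V ≤ hi κ p q + (k + 1).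
-- The tables are chosen so that this invariant survives every halving
-- (checked by finite computation in the lemmas transports-… below).
lo : Class → ℕ → ℕ → ℤ
lo κ1    = grid (+ 0 , + 0 , + 0) (+ 1 , + 1 , + 1) (+ 2 , + 2 , + 2)
lo κpow  = grid (+ 1 , + 0 , + 1) (+ 3 , + 1 , + 2) (+ 2 , + 2 , + 2)
lo κeven = grid (+ 1 , + 0 , + 0) (+ 3 , + 1 , + 2) (+ 2 , + 1 , + 2)
lo κodd  = grid (+ 0 , + 0 , + 0) (+ 2 , + 1 , + 2) (+ 3 , + 1 , + 1)

hi : Class → ℕ → ℕ → ℤ
hi κ1    = grid (-2 , -2 , -2) (-1 , -1 , -1) (+ 0 , + 0 , + 0)
hi κpow  = grid (-2 , -3 , -3) (-1 , -1 , -1) (+ 0 , -2 , -1)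
hi κeven = grid (-2 , -3 , -2) (+ 0 , -1 , -1) (+ 0 , -2 , -1)
hi κodd  = grid (-1 , -3 , -2) (+ 0 , -1 , -1) (-1 , -1 , + 0)

radius : ℕ → ℤ
radius k = + suc k

radius-+ : ∀ δ k → radius (δ + k) ≡ radius k +ᶻ + δ
radius-+ δ k = trans (cong (λ x → + suc x) (+-comm δ k)) (ℤ.pos-+ (suc k) δ)

Within : ℕ → ℕ → ℕ → ℕ → Class → Set
Within c a n k κ =
  (lo κ (τ c a) (τ c (a + n)) ≤ᶻ V c a n +ᶻ radius k) × (V c a n -ᶻ radius k ≤ᶻ hi κ (τ c a) (τ c (a + n)))

split : ∀ {x y} → T (x ∧ y) → T x × T y
split = Equivalence.to T-∧

allLetters : (ℕ → Bool) → Bool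
allLetters f = f 0 ∧ f 1 ∧ f 2

allLetters-sound : ∀ f → T (allLetters f) → ∀ p → p ≤ 2 → T (f p)
allLetters-sound f ok 0 _ = proj₁ (split {f 0} ok)
allLetters-sound f ok 1 _ = proj₁ (split {f 1} (proj₂ (split {f 0} ok)))
allLetters-sound f ok 2 _ = proj₂ (split {f 1} (proj₂ (split {f 0} ok)))
allLetters-sound f ok (suc (suc (suc _))) (s≤s (s≤s ()))

allPairs : (ℕ → ℕ → Bool) → Bool
allPairs f = allLetters λ p → allLetters (f p)

allPairs-sound : ∀ f → T (allPairs f) → ∀ p q → p ≤ 2 → q ≤ 2 → T (f p q)
allPairs-sound f ok p q p≤2 q≤2 = allLetters-sound (f p) (allLetters-sound (λ p → allLetters (f p)) ok p p≤2) q q≤2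

-- The class-μ bounds of the halved window (in τ (c + 2), whose letters are
-- rot² of those of τ c) imply the class-κ bounds of the original window,
-- for every pair of letters (p, q) = (τ c A, τ c (A + M)), when the radius
-- grows by δ.
transportsAt : Bool → Bool → Class → Class → ℕ → ℕ → ℕ → Bool
transportsAt b b' κ μ δ p q =
  ((-ᶻ lo μ p' q' +ᶻ β -ᶻ + δ) ≤ᵇᶻ hi κ (rotIf b p) (rotIf b' q)) ∧
  (lo κ (rotIf b p) (rotIf b' q) ≤ᵇᶻ (-ᶻ hi μ p' q' +ᶻ β +ᶻ + δ))
  where
  p' = rot (rot p)
  q' = rot (rot q)
  β = boundary b b' p q

transports : Bool → Bool → Class → Class → ℕ → Bool
transports b b' κ μ δ = allPairs (transportsAt b b' κ μ δ)

reflect-bounds : ∀ {v r β δ lo' hi' loκ hiκ} →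
  lo' ≤ᶻ v +ᶻ r → v -ᶻ r ≤ᶻ hi' →
  -ᶻ lo' +ᶻ β -ᶻ + δ ≤ᶻ hiκ → loκ ≤ᶻ -ᶻ hi' +ᶻ β +ᶻ + δ →
  (loκ ≤ᶻ (-ᶻ v +ᶻ β) +ᶻ (r +ᶻ + δ)) × ((-ᶻ v +ᶻ β) -ᶻ (r +ᶻ + δ) ≤ᶻ hiκ)
reflect-bounds {v} {r} {β} {δ} {lo'} {hi'} {loκ} {hiκ} lo'≤ ≤hi' lower upper = lower-bound , upper-bound
  where
  open ℤ.≤-Reasoning
  lower-bound : loκ ≤ᶻ (-ᶻ v +ᶻ β) +ᶻ (r +ᶻ + δ)
  lower-bound = begin
    loκ                             ≤⟨ upper ⟩
    -ᶻ hi' +ᶻ β +ᶻ + δ              ≤⟨ ℤ.+-monoˡ-≤ (+ δ) (ℤ.+-monoˡ-≤ β (ℤ.neg-mono-≤ ≤hi')) ⟩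
    -ᶻ (v -ᶻ r) +ᶻ β +ᶻ + δ         ≡⟨ regroup v r β (+ δ) ⟩
    (-ᶻ v +ᶻ β) +ᶻ (r +ᶻ + δ)       ∎
    where
    regroup : ∀ v r β δ → -ᶻ (v -ᶻ r) +ᶻ β +ᶻ δ ≡ (-ᶻ v +ᶻ β) +ᶻ (r +ᶻ δ)
    regroup = solve-∀
  upper-bound : (-ᶻ v +ᶻ β) -ᶻ (r +ᶻ + δ) ≤ᶻ hiκ
  upper-bound = begin
    (-ᶻ v +ᶻ β) -ᶻ (r +ᶻ + δ)       ≡⟨ regroup v r β (+ δ) ⟩
    -ᶻ (v +ᶻ r) +ᶻ β -ᶻ + δ         ≤⟨ ℤ.+-monoˡ-≤ (-ᶻ + δ) (ℤ.+-monoˡ-≤ β (ℤ.neg-mono-≤ lo'≤)) ⟩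
    -ᶻ lo' +ᶻ β -ᶻ + δ              ≤⟨ lower ⟩
    hiκ                             ∎
    where
    regroup : ∀ v r β δ → (-ᶻ v +ᶻ β) -ᶻ (r +ᶻ δ) ≡ -ᶻ (v +ᶻ r) +ᶻ β -ᶻ δ
    regroup = solve-∀

transport : ∀ {a n b b'} (H : Halving a n b b') c κ μ δ k →
  Within (suc (suc c)) (Halving.A H) (Halving.M H) k μ → T (transports b b' κ μ δ) →
  Within c a n (δ + k) κ
transport {a} {n} {b} {b'} H c κ μ δ k (lo≤ , ≤hi) ok =
  reshape (sym (halving-first H c)) (sym (halving-last H c)) (sym (halving-V H c)) (sym (radius-+ δ k))
    (reflect-bounds {v = V (suc (suc c)) A M} {r = radius k} lo≤ ≤hi (ℤ.≤ᵇ⇒≤ lower) (ℤ.≤ᵇ⇒≤ upper))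
  where
  open Halving H
  checked = allPairs-sound (transportsAt b b' κ μ δ) ok (τ c A) (τ c (A + M)) (τ≤2 c A) (τ≤2 c (A + M))
  lower = proj₁ (split checked)
  upper = proj₂ (split checked)
  Shape : ℕ → ℕ → ℤ → ℤ → Set
  Shape x y v r = (lo κ x y ≤ᶻ v +ᶻ r) × (v -ᶻ r ≤ᶻ hi κ x y)
  reshape : ∀ {x x' y y' v v' r r'} → x ≡ x' → y ≡ y' → v ≡ v' → r ≡ r' → Shape x y v r → Shape x' y' v' r'
  reshape refl refl refl refl s = s

transports-EE : ∀ μ → T (transports false false (double μ) μ 1)
transports-EE κ1 = tt
transports-EE κpow = tt
transports-EE κeven = tt
transports-EE κodd = tt

transports-OO : ∀ μ → T (transports true true (double μ) μ 1)
transports-OO κ1 = tt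
transports-OO κpow = tt
transports-OO κeven = tt
transports-OO κodd = tt

transports-EO : ∀ μ → T (transports false true κodd μ 1)
transports-EO κ1 = tt
transports-EO κpow = tt
transports-EO κeven = tt
transports-EO κodd = tt

transports-OE-power : T (transports true false κodd κpow 0)
transports-OE-power = tt

transports-OE : ∀ μ → (μ ≡ κeven) ⊎ (μ ≡ κodd) → T (transports true false κodd μ 1)
transports-OE .κeven (inj₁ refl) = tt
transports-OE .κodd (inj₂ refl) = tt

within-single : ∀ c a → Within c a 1 0 κ1
within-single c a = subst (λ v → (lo κ1 p q ≤ᶻ v +ᶻ + 1) × (v -ᶻ + 1 ≤ᶻ hi κ1 p q)) (sym (V-single c a))
  (ℤ.≤ᵇ⇒≤ (proj₁ (split checked)) , ℤ.≤ᵇ⇒≤ (proj₂ (split checked)))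
  where
  p = τ c a
  q = τ c (a + 1)
  single-ok : ℕ → ℕ → Bool
  single-ok p q = (lo κ1 p q ≤ᵇᶻ h p +ᶻ + 1) ∧ (h p -ᶻ + 1 ≤ᵇᶻ hi κ1 p q)
  checked = allPairs-sound single-ok tt p q (τ≤2 c a) (τ≤2 c (a + 1))

half<double : ∀ {m} → 1 ≤ m → m < m + m
half<double {m} 1≤m = subst (_≤ m + m) (+-comm m 1) (+-monoʳ-≤ m 1≤m)

half+1<odd : ∀ {m} → 1 ≤ m → suc m < suc (m + m)
half+1<odd 1≤m = s≤s (half<double 1≤m)

class-of-power : ∀ {m} k → suc m ≡ 2 ^ suc k → class (suc m) (suc k) ≡ κpow
class-of-power k e = trans (cong (λ x → class x (suc k)) e) (class-power k)

-- Strong induction on n along the halvings n ↦ m (n = 2m) and n ↦ m, m + 1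
-- (n = 2m + 1), for a property Q of a length, its level and its class.
class-induction : (Q : ℕ → ℕ → Class → Set) →
  Q 1 0 κ1 →
  (∀ m k μ → Q m k μ → Q (m + m) (suc k) (double μ)) →
  (∀ m k μ → Q m k μ → Q (suc m) (suc k) κpow → Q (suc (m + m)) (suc k) κodd) →
  (∀ m k μ μ' → (μ' ≡ κeven) ⊎ (μ' ≡ κodd) → Q m (suc k) μ → Q (suc m) (suc k) μ' → Q (suc (m + m)) (suc (suc k)) κodd) →
  ∀ n k → Level n k → Q n k (class n k)
class-induction Q at-1 at-even at-odd-power at-odd-nonpower = <-rec (λ n → ∀ k → Level n k → Q n k (class n k)) step
  where
  step : ∀ n → (∀ {m} → m < n → ∀ k → Level m k → Q m k (class m k)) → ∀ k → Level n k → Q n k (class n k)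
  step n rec k lv with parity n
  step _ rec k lv | even m with level-even m k lv
  ... | k' , refl , lvm = subst (Q (m + m) (suc k')) (sym (class-even m k' lvm))
                                (at-even m k' (class m k') (rec (half<double (level-pos k' lvm)) k' lvm))
  step _ rec zero lv | odd m with level-odd-0 m lv
  ... | refl = at-1
  step _ rec (suc k') lv | odd m with level-succ-half m k' lv
  ... | inj₁ (m+1≡2^ , lv₁) =
    subst (Q (suc (m + m)) (suc k')) (sym (class-odd m k'))
      (at-odd-power m k' (class m k') (rec (s≤s (m≤m+n m m)) k' (level-odd m k' lv))
        (subst (Q (suc m) (suc k')) (class-of-power k' m+1≡2^) (rec (half+1<odd (level-pos k' (level-odd m k' lv))) (suc k') lv₁)))
  ... | inj₂ (k'' , refl , lv₁ , 2^<m+1) =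
    subst (Q (suc (m + m)) (suc k')) (sym (class-odd m k'))
      (at-odd-nonpower m k'' (class m k') (class (suc m) k') (class-nonpower (suc m) k'' 2^<m+1)
        (rec (s≤s (m≤m+n m m)) k' (level-odd m k' lv))
        (rec (half+1<odd (level-pos k' (level-odd m k' lv))) k' lv₁))

Bounds : ℕ → ℕ → Class → Set
Bounds n k κ = ∀ c a → Within c a n k κ

bounds-even : ∀ m k μ → Bounds m k μ → Bounds (m + m) (suc k) (double μ)
bounds-even m k μ half c a with parity a
... | even A = transport (halving-EE A m) c (double μ) μ 1 k (half (suc (suc c)) A) (transports-EE μ)
... | odd A = transport (halving-OO A m) c (double μ) μ 1 k (half (suc (suc c)) A) (transports-OO μ)

bounds-odd : ∀ m k μ k' μ' δ → δ + k' ≡ suc k → T (transports true false κodd μ' δ) →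
  Bounds m k μ → Bounds (suc m) k' μ' → Bounds (suc (m + m)) (suc k) κodd
bounds-odd m k μ k' μ' δ eq ok half half' c a with parity a
... | even A = transport (halving-EO A m) c κodd μ 1 k (half (suc (suc c)) A) (transports-EO μ)
... | odd A = subst (λ k → Within c (suc (A + A)) (suc (m + m)) k κodd) eq
                    (transport (halving-OE A m) c κodd μ' δ k' (half' (suc (suc c)) A) ok)

bounded : ∀ n k → Level n k → Bounds n k (class n k)
bounded = class-induction Bounds within-single bounds-even
  (λ m k μ half half' → bounds-odd m k μ (suc k) κpow 0 refl transports-OE-power half half')
  (λ m k μ μ' nonpower half half' → bounds-odd m (suc k) μ (suc k) μ' 1 refl (transports-OE μ' nonpower) half half')

rotations : ∀ x y → x ≤ 2 → y ≤ 2 → (x ≡ y) ⊎ (x ≡ rot y) ⊎ (x ≡ rot (rot y))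
rotations 0 0 _ _ = inj₁ refl
rotations 0 1 _ _ = inj₂ (inj₂ refl)
rotations 0 2 _ _ = inj₂ (inj₁ refl)
rotations 1 0 _ _ = inj₂ (inj₁ refl)
rotations 1 1 _ _ = inj₁ refl
rotations 1 2 _ _ = inj₂ (inj₂ refl)
rotations 2 0 _ _ = inj₂ (inj₂ refl)
rotations 2 1 _ _ = inj₂ (inj₁ refl)
rotations 2 2 _ _ = inj₁ refl
rotations (suc (suc (suc x))) y (s≤s (s≤s ())) _
rotations 0 (suc (suc (suc y))) _ (s≤s (s≤s ()))
rotations 1 (suc (suc (suc y))) _ (s≤s (s≤s ()))
rotations 2 (suc (suc (suc y))) _ (s≤s (s≤s ()))

PairOccurs : ℕ → ℕ → ℕ → ℕ → Set
PairOccurs N c p q = Σ ℕ λ a → N ≤ a × τ c a ≡ p × τ c (a + 1) ≡ q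

-- Every letter occurs in τ c beyond any position: the letters at 1, 3, 7
-- are y, rot y, rot² y, and an occurrence at a recurs at 2a.
letter-occurs : ∀ N c x → x ≤ 2 → Σ ℕ λ a → N < a × τ c a ≡ x
letter-occurs zero c x x≤2 with rotations x (τ c 1) x≤2 (τ≤2 c 1)
... | inj₁ e = 1 , s≤s z≤n , sym e
... | inj₂ (inj₁ e) = 3 , s≤s z≤n , trans (τ-odd c 1) (sym e)
... | inj₂ (inj₂ e) = 7 , s≤s z≤n , trans (τ-odd c 3) (trans (cong rot (τ-odd c 1)) (sym e))
letter-occurs (suc N) c x x≤2 with letter-occurs N c x x≤2
... | a , N<a , e = a + a , ≤-trans (≤-reflexive (sym (+-comm (suc N) 1))) (+-mono-≤ N<a (≤-trans (s≤s z≤n) N<a)) ,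
                     trans (τ-even c a) e

τ-after-odd : ∀ c A → τ c (suc (A + A) + 1) ≡ τ c (A + 1)
τ-after-odd c A = begin
  τ c (suc (A + A) + 1)   ≡⟨ cong (τ c) (trans (+-comm (suc (A + A)) 1) (cong suc (sym (+-suc A A)))) ⟩
  τ c (suc A + suc A)     ≡⟨ τ-even c (suc A) ⟩
  τ c (suc A)             ≡⟨ cong (τ c) (+-comm 1 A) ⟩
  τ c (A + 1)             ∎
  where open ≡-Reasoning

-- Consecutive letters x, rot x occur at every even position 2a with τ c a = x.
pair-rot : ∀ N c x → x ≤ 2 → PairOccurs N c x (rot x)
pair-rot N c x x≤2 with letter-occurs N c x x≤2
... | A , N<A , e = A + A , ≤-trans (<⇒≤ N<A) (m≤m+n A A) , trans (τ-even c A) e ,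
        trans (cong (τ c) (+-comm (A + A) 1)) (trans (τ-odd c A) (cong rot e))

-- An occurrence of (y, y') at A yields (rot y, y') at the odd position 2A + 1.
pair-shift : ∀ N c y y' → PairOccurs N c y y' → PairOccurs N c (rot y) y'
pair-shift N c y y' (A , N≤A , e , e') =
  suc (A + A) , ≤-trans N≤A (≤-trans (m≤m+n A A) (n≤1+n _)) , trans (τ-odd c A) (cong rot e) , trans (τ-after-odd c A) e'

-- A repeated letter x x occurs at 2A + 1 when (rot² x, x) occurs at A.
pair-equal : ∀ N c x → x ≤ 2 → PairOccurs N c x x
pair-equal N c x x≤2 = subst (λ y → PairOccurs N c y x) (rot³ x x≤2)
  (pair-shift N c _ _ (subst (PairOccurs N c (rot (rot x))) (rot³ x x≤2) (pair-rot N c (rot (rot x)) (rot≤2 _))))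

pair-occurs : ∀ N c p q → p ≤ 2 → q ≤ 2 → PairOccurs N c p q
pair-occurs N c p q p≤2 q≤2 with rotations q p q≤2 p≤2
... | inj₁ refl = pair-equal N c p p≤2
... | inj₂ (inj₁ refl) = pair-rot N c p p≤2
... | inj₂ (inj₂ refl) = subst (λ y → PairOccurs N c y (rot (rot p))) (rot³ p p≤2)
                               (pair-shift N c _ _ (pair-equal N c (rot (rot p)) (rot≤2 _)))

-- An extremal configuration of a window: its first letter, its end letter
-- (the letter just after it) and the value ±(k + 1) + offset of its centred sum.
record Config : Set where
  constructor cfg
  field
    first last : ℕ
    positive : Bool
    offset : ℤ
open Config

signed : Bool → ℤ → ℤ
signed true r = r
signed false r = -ᶻ r

Realises : ℕ → ℕ → ℕ → ℕ → Config → Set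
Realises c a n k x =
  τ c a ≡ first x × τ c (a + n) ≡ last x × V c a n ≡ signed (positive x) (radius k) +ᶻ offset x

-- For each class, configurations that are realised by windows of that class
-- at arbitrarily large positions; the first one attains the upper bound.
configs : Class → List Config
configs κ1 =
  cfg 2 0 true (+ 0) ∷
  cfg 0 0 false (+ 0) ∷ cfg 0 0 true -2 ∷ cfg 0 1 false (+ 0) ∷ cfg 0 1 true -2 ∷
  cfg 0 2 false (+ 0) ∷ cfg 0 2 true -2 ∷ cfg 1 0 false (+ 1) ∷ cfg 1 0 true -1 ∷
  cfg 1 1 false (+ 1) ∷ cfg 1 1 true -1 ∷ cfg 1 2 false (+ 1) ∷ cfg 1 2 true -1 ∷
  cfg 2 0 false (+ 2) ∷ cfg 2 1 false (+ 2) ∷ cfg 2 1 true (+ 0) ∷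
  cfg 2 2 false (+ 2) ∷ cfg 2 2 true (+ 0) ∷ []
configs κpow =
  cfg 2 0 true (+ 0) ∷
  cfg 0 1 false (+ 0) ∷ cfg 0 1 false (+ 1) ∷ cfg 0 2 false (+ 1) ∷ cfg 1 0 true -1 ∷
  cfg 1 2 false (+ 2) ∷ cfg 1 2 true -2 ∷ cfg 1 2 true -1 ∷ cfg 2 0 false (+ 2) ∷
  cfg 2 1 false (+ 2) ∷ []
configs κeven =
  cfg 1 0 true (+ 0) ∷
  cfg 0 1 false (+ 0) ∷ cfg 0 2 false (+ 0) ∷ cfg 0 2 true -2 ∷ cfg 1 2 true -1 ∷
  cfg 2 0 false (+ 2) ∷ cfg 2 0 true (+ 0) ∷ cfg 2 1 false (+ 1) ∷ []
configs κodd =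
  cfg 1 0 true (+ 0) ∷
  cfg 0 0 false (+ 1) ∷ cfg 0 1 false (+ 0) ∷ cfg 1 2 true -1 ∷ cfg 2 1 false (+ 1) ∷
  cfg 2 2 true -1 ∷ []

-- x arises by halving (b, b') with radius growth δ from y realised in τ (c + 2):
-- there the letters are rot of those of y and the sign flips.
derives : Bool → Bool → ℕ → Config → Config → Bool
derives b b' δ x y =
  ⌊ first x ≟ rotIf b p ⌋ ∧ ⌊ last x ≟ rotIf b' q ⌋ ∧ ⌊ positive x Bool.≟ not (positive y) ⌋ ∧
  ⌊ offset x ℤ.≟ -ᶻ offset y +ᶻ boundary b b' p q -ᶻ signed (positive x) (+ δ) ⌋
  where
  p = rot (first y)
  q = rot (last y)

un-rot² : ∀ c A y → τ (suc (suc c)) A ≡ y → τ c A ≡ rot y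
un-rot² c A y e = trans (sym (rot³ (τ c A) (τ≤2 c A))) (cong rot e)

realise-step : ∀ {a n b b'} (H : Halving a n b b') c δ k x y → T (derives b b' δ x y) →
  Realises (suc (suc c)) (Halving.A H) (Halving.M H) k y → Realises c a n (δ + k) x
realise-step {a} {n} {b} {b'} H c δ k x y ok (first-y , last-y , value-y) =
  first-x , last-x , value-x
  where
  open Halving H
  checks₁ = split {⌊ first x ≟ rotIf b (rot (first y)) ⌋} ok
  checks₂ = split {⌊ last x ≟ rotIf b' (rot (last y)) ⌋} (proj₂ checks₁)
  checks₃ = split {⌊ positive x Bool.≟ not (positive y) ⌋} (proj₂ checks₂)
  p≡ = un-rot² c A (first y) first-y
  q≡ = un-rot² c (A + M) (last y) last-y
  first-x : τ c a ≡ first x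
  first-x = trans (halving-first H c) (trans (cong (rotIf b) p≡) (sym (toWitness (proj₁ checks₁))))
  last-x : τ c (a + n) ≡ last x
  last-x = trans (halving-last H c) (trans (cong (rotIf b') q≡) (sym (toWitness (proj₁ checks₂))))
  flip : ∀ {sx sy oy β r δ} → sx ≡ not sy →
    -ᶻ (signed sy r +ᶻ oy) +ᶻ β ≡ signed sx (r +ᶻ δ) +ᶻ (-ᶻ oy +ᶻ β -ᶻ signed sx δ)
  flip {sy = true} {oy} {β} {r} {δ} refl = regroup oy β r δ
    where
    regroup : ∀ o β r δ → -ᶻ (r +ᶻ o) +ᶻ β ≡ -ᶻ (r +ᶻ δ) +ᶻ (-ᶻ o +ᶻ β -ᶻ (-ᶻ δ))
    regroup = solve-∀
  flip {sy = false} {oy} {β} {r} {δ} refl = regroup oy β r δ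
    where
    regroup : ∀ o β r δ → -ᶻ (-ᶻ r +ᶻ o) +ᶻ β ≡ (r +ᶻ δ) +ᶻ (-ᶻ o +ᶻ β -ᶻ δ)
    regroup = solve-∀
  value-x : V c a n ≡ signed (positive x) (radius (δ + k)) +ᶻ offset x
  value-x = begin
    V c a n                                                          ≡⟨ halving-V H c ⟩
    -ᶻ V (suc (suc c)) A M +ᶻ boundary b b' (τ c A) (τ c (A + M))   ≡⟨ cong₂ (λ v β → -ᶻ v +ᶻ β) value-y (cong₂ (boundary b b') p≡ q≡) ⟩
    -ᶻ (signed (positive y) (radius k) +ᶻ offset y) +ᶻ boundary b b' (rot (first y)) (rot (last y))
                                                                     ≡⟨ flip (toWitness (proj₁ checks₃)) ⟩
    signed (positive x) (radius k +ᶻ + δ) +ᶻ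
      (-ᶻ offset y +ᶻ boundary b b' (rot (first y)) (rot (last y)) -ᶻ signed (positive x) (+ δ))
                                                                     ≡⟨ cong₂ (λ r o → signed (positive x) r +ᶻ o) (sym (radius-+ δ k))
                                                                              (sym (toWitness (proj₂ checks₃))) ⟩
    signed (positive x) (radius (δ + k)) +ᶻ offset x                ∎
    where open ≡-Reasoning

derivable : Bool → Bool → Class → ℕ → Config → Bool
derivable b b' μ δ x = any (derives b b' δ x) (configs μ)

evenRule : Class → Config → Bool
evenRule μ x = derivable false false μ 1 x ∨ derivable true true μ 1 x

oddRule : Class → Class → ℕ → Config → Bool
oddRule μ μ' δ x = derivable false true μ 1 x ∨ derivable true false μ' δ x

derivable-even : ∀ μ → T (all (evenRule μ) (configs (double μ)))
derivable-even κ1 = tt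
derivable-even κpow = tt
derivable-even κeven = tt
derivable-even κodd = tt

derivable-odd : Class → Class → ℕ → Bool
derivable-odd μ μ' δ = all (oddRule μ μ' δ) (configs κodd)

derivable-odd-power : ∀ μ → T (derivable-odd μ κpow 0)
derivable-odd-power κ1 = tt
derivable-odd-power κpow = tt
derivable-odd-power κeven = tt
derivable-odd-power κodd = tt

derivable-odd-nonpower : ∀ μ μ' → (μ' ≡ κeven) ⊎ (μ' ≡ κodd) → T (derivable-odd μ μ' 1)
derivable-odd-nonpower κ1 .κeven (inj₁ refl) = tt
derivable-odd-nonpower κpow .κeven (inj₁ refl) = tt
derivable-odd-nonpower κeven .κeven (inj₁ refl) = tt
derivable-odd-nonpower κodd .κeven (inj₁ refl) = tt
derivable-odd-nonpower κ1 .κodd (inj₂ refl) = tt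
derivable-odd-nonpower κpow .κodd (inj₂ refl) = tt
derivable-odd-nonpower κeven .κodd (inj₂ refl) = tt
derivable-odd-nonpower κodd .κodd (inj₂ refl) = tt

checked-at : ∀ {A : Set} (p : A → Bool) xs → T (all p xs) → ∀ {x} → x ∈ xs → T (p x)
checked-at p xs ok x∈ = lookup (all⁺ p xs ok) x∈

Occurs : ℕ → ℕ → Class → Set
Occurs n k κ = ∀ x → x ∈ configs κ → ∀ c N → Σ ℕ λ a → N ≤ a × Realises c a n k x

pos-≥ : ∀ b A → A ≤ pos b A
pos-≥ false A = m≤m+n A A
pos-≥ true A = ≤-trans (m≤m+n A A) (n≤1+n _)

derive : ∀ {n b b'} μ δ k (halve : ∀ A → Halving (pos b A) n b b') →
  (∀ y → y ∈ configs μ → ∀ c N → Σ ℕ λ A → N ≤ A × Realises c (Halving.A (halve A)) (Halving.M (halve A)) k y) →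
  ∀ x → T (derivable b b' μ δ x) → ∀ c N → Σ ℕ λ a → N ≤ a × Realises c a n (δ + k) x
derive {b = b} {b'} μ δ k halve occurs x ok c N
  with find (any⁻ (derives b b' δ x) (configs μ) ok)
... | y , y∈ , derived with occurs y y∈ (suc (suc c)) N
...   | A , N≤A , realised = pos b A , ≤-trans N≤A (pos-≥ b A) , realise-step (halve A) c δ k x y derived realised

occurs-single : Occurs 1 0 κ1
occurs-single x x∈ c N with split {first x ≤ᵇ 2} (checked-at single-ok (configs κ1) tt x∈)
  where
  single-ok : Config → Bool
  single-ok x = (first x ≤ᵇ 2) ∧ (last x ≤ᵇ 2) ∧ ⌊ h (first x) ℤ.≟ signed (positive x) (+ 1) +ᶻ offset x ⌋
... | first≤2 , rest with split {last x ≤ᵇ 2} rest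
...   | last≤2 , value with pair-occurs N c (first x) (last x) (≤ᵇ⇒≤ _ _ first≤2) (≤ᵇ⇒≤ _ _ last≤2)
...     | a , N≤a , first-a , last-a = a , N≤a , first-a , last-a , trans (V-single c a) (trans (cong h first-a) (toWitness value))

occurs-even : ∀ m k μ → Occurs m k μ → Occurs (m + m) (suc k) (double μ)
occurs-even m k μ half x x∈ c N with Equivalence.to T-∨ (checked-at (evenRule μ) (configs (double μ)) (derivable-even μ) x∈)
... | inj₁ d = derive μ 1 k (λ A → halving-EE A m) half x d c N
... | inj₂ d = derive μ 1 k (λ A → halving-OO A m) half x d c N

occurs-odd : ∀ m k μ k' μ' δ → δ + k' ≡ suc k → T (derivable-odd μ μ' δ) →
  Occurs m k μ → Occurs (suc m) k' μ' → Occurs (suc (m + m)) (suc k) κodd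
occurs-odd m k μ k' μ' δ eq ok half half' x x∈ c N
  with Equivalence.to T-∨ (checked-at (oddRule μ μ' δ) (configs κodd) ok x∈)
... | inj₁ d = derive μ 1 k (λ A → halving-EO A m) half x d c N
... | inj₂ d = subst (λ k → Σ ℕ λ a → N ≤ a × Realises c a (suc (m + m)) k x) eq
                     (derive μ' δ k' (λ A → halving-OE A m) half' x d c N)

realisable : ∀ n k → Level n k → Occurs n k (class n k)
realisable = class-induction Occurs occurs-single occurs-even
  (λ m k μ half half' → occurs-odd m k μ (suc k) κpow 0 refl (derivable-odd-power μ) half half')
  (λ m k μ μ' nonpower half half' → occurs-odd m (suc k) μ (suc k) μ' 1 refl (derivable-odd-nonpower μ μ' nonpower) half half')

-- The digit sum of σ^e(a) is 2^e - 1 + excess (e mod 6) a: the excess is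
-- 6-periodic in e because DS σ^{e+1}(a) = DS σ^e(a) + DS σ^e(rot a).
excess : ℕ → ℕ → ℕ
excess 0 0 = 0
excess 0 1 = 1
excess 0 _ = 2
excess 1 0 = 0
excess 1 1 = 2
excess 1 _ = 1
excess 2 0 = 1
excess 2 1 = 2
excess 2 _ = 0
excess 3 0 = 2
excess 3 1 = 1
excess 3 _ = 0
excess 4 0 = 2
excess 4 1 = 0
excess 4 _ = 1
excess _ 0 = 1
excess _ 1 = 0
excess _ _ = 2

excess-step : ∀ e a → e < 6 → a ≤ 2 → excess e a + excess e (rot a) ≡ excess (suc e % 6) a + 1
excess-step 0 0 _ _ = refl
excess-step 0 1 _ _ = refl
excess-step 0 2 _ _ = refl
excess-step 1 0 _ _ = refl
excess-step 1 1 _ _ = refl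
excess-step 1 2 _ _ = refl
excess-step 2 0 _ _ = refl
excess-step 2 1 _ _ = refl
excess-step 2 2 _ _ = refl
excess-step 3 0 _ _ = refl
excess-step 3 1 _ _ = refl
excess-step 3 2 _ _ = refl
excess-step 4 0 _ _ = refl
excess-step 4 1 _ _ = refl
excess-step 4 2 _ _ = refl
excess-step 5 0 _ _ = refl
excess-step 5 1 _ _ = refl
excess-step 5 2 _ _ = refl
excess-step (suc (suc (suc (suc (suc (suc e)))))) a (s≤s (s≤s (s≤s (s≤s (s≤s (s≤s ())))))) _
excess-step (suc e) (suc (suc (suc a))) _ (s≤s (s≤s ()))
excess-step 0 (suc (suc (suc a))) _ (s≤s (s≤s ()))

suc-mod-6 : ∀ e → suc e % 6 ≡ suc (e % 6) % 6
suc-mod-6 e = begin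
  suc e % 6                      ≡⟨ cong (λ x → suc x % 6) (m≡m%n+[m/n]*n e 6) ⟩
  (suc (e % 6) + e / 6 * 6) % 6  ≡⟨ [m+kn]%n≡m%n (suc (e % 6)) (e / 6) 6 ⟩
  suc (e % 6) % 6                ∎
  where open ≡-Reasoning

DS-block : ∀ e a → a ≤ 2 → DS (block e a) + 1 ≡ 2 ^ e + excess (e % 6) a
DS-block zero 0 _ = refl
DS-block zero 1 _ = refl
DS-block zero 2 _ = refl
DS-block zero (suc (suc (suc a))) (s≤s (s≤s ()))
DS-block (suc e) a a≤2 = suc-injective (begin
  suc (DS (block (suc e) a) + 1)                        ≡⟨ cong (λ x → suc (x + 1)) DS-split ⟩
  suc (DS (block e a) + DS (block e (rot a)) + 1)       ≡⟨ regroup₁ (DS (block e a)) (DS (block e (rot a))) ⟩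
  (DS (block e a) + 1) + (DS (block e (rot a)) + 1)     ≡⟨ cong₂ _+_ (DS-block e a a≤2) (DS-block e (rot a) (rot≤2 a)) ⟩
  (2 ^ e + excess (e % 6) a) + (2 ^ e + excess (e % 6) (rot a))
                                                         ≡⟨ regroup₂ (2 ^ e) (excess (e % 6) a) (excess (e % 6) (rot a)) ⟩
  2 * 2 ^ e + (excess (e % 6) a + excess (e % 6) (rot a))
                                                         ≡⟨ cong (λ x → 2 * 2 ^ e + x) (excess-step (e % 6) a (m%n<n e 6) a≤2) ⟩
  2 * 2 ^ e + (excess (suc (e % 6) % 6) a + 1)          ≡⟨ cong (λ x → 2 * 2 ^ e + (excess x a + 1)) (sym (suc-mod-6 e)) ⟩
  2 * 2 ^ e + (excess (suc e % 6) a + 1)                ≡⟨ regroup₃ (2 ^ e) (excess (suc e % 6) a) ⟩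
  suc (2 ^ suc e + excess (suc e % 6) a)                ∎)
  where
  open ≡-Reasoning
  DS-split : DS (block (suc e) a) ≡ DS (block e a) + DS (block e (rot a))
  DS-split = trans (cong DS (block-suc e a a≤2)) (sum-++ (block e a) (block e (rot a)))
  regroup₁ : ∀ x y → suc (x + y + 1) ≡ (x + 1) + (y + 1)
  regroup₁ = solve-∀ℕ
  regroup₂ : ∀ p x y → (p + x) + (p + y) ≡ 2 * p + (x + y)
  regroup₂ = solve-∀ℕ
  regroup₃ : ∀ p x → 2 * p + (x + 1) ≡ suc (2 * p + x)
  regroup₃ = solve-∀ℕ

-- The letters d_e are chosen so that σ^e(d_e) has the maximal excess 2.
d-excess : ∀ e → d e ≤ 2 × excess (e % 6) (d e) ≡ 2
d-excess e with e % 6 | m%n<n e 6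
... | 0 | _ = s≤s (s≤s z≤n) , refl
... | 1 | _ = s≤s z≤n , refl
... | 2 | _ = s≤s z≤n , refl
... | 3 | _ = z≤n , refl
... | 4 | _ = z≤n , refl
... | 5 | _ = s≤s (s≤s z≤n) , refl
... | suc (suc (suc (suc (suc (suc _))))) | s≤s (s≤s (s≤s (s≤s (s≤s (s≤s ())))))

DS-blk : ∀ e → DS (blk e) ≡ 2 ^ e + 1
DS-blk e = +-cancelʳ-≡ 1 (DS (blk e)) (2 ^ e + 1)
  (trans (DS-block e (d e) (proj₁ (d-excess e))) (trans (cong (λ x → 2 ^ e + x) (proj₂ (d-excess e))) (sym (+-assoc (2 ^ e) 1 1))))

∑ : (ℕ → ℕ) → ℕ → ℕ
∑ f zero = 0
∑ f (suc n) = ∑ f n + f n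

∑-cong : ∀ {f g} n → (∀ j → f j ≡ g j) → ∑ f n ≡ ∑ g n
∑-cong zero f≗g = refl
∑-cong (suc n) f≗g = cong₂ _+_ (∑-cong n f≗g) (f≗g n)

∑-front : ∀ f n → ∑ f (suc n) ≡ f 0 + ∑ (λ j → f (suc j)) n
∑-front f zero = +-comm 0 (f 0)
∑-front f (suc n) = trans (cong (_+ f (suc n)) (∑-front f n)) (+-assoc (f 0) _ _)

∑-double : ∀ f n → ∑ (λ j → 2 * f j) n ≡ 2 * ∑ f n
∑-double f zero = refl
∑-double f (suc n) = trans (cong (_+ 2 * f n) (∑-double f n)) (sym (*-distribˡ-+ 2 (∑ f n) (f n)))

∑-double+1 : ∀ f n → ∑ (λ j → 2 * f j + 1) n ≡ 2 * ∑ f n + n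
∑-double+1 f zero = refl
∑-double+1 f (suc n) = trans (cong (_+ (2 * f n + 1)) (∑-double+1 f n)) (regroup (∑ f n) (f n) n)
  where
  regroup : ∀ s x n → 2 * s + n + (2 * x + 1) ≡ 2 * (s + x) + suc n
  regroup = solve-∀ℕ

∑-interleave : ∀ f L → ∑ (λ i → f (suc (i + i))) L + ∑ (λ i → f (i + i)) L ≡ ∑ f (L + L)
∑-interleave f zero = refl
∑-interleave f (suc L) = begin
  (odds + f (suc (L + L))) + (evens + f (L + L))   ≡⟨ regroup odds (f (suc (L + L))) evens (f (L + L)) ⟩
  (odds + evens) + f (L + L) + f (suc (L + L))     ≡⟨ cong (λ x → x + f (L + L) + f (suc (L + L))) (∑-interleave f L) ⟩
  ∑ f (suc (suc (L + L)))                          ≡⟨ cong (∑ f) (cong suc (sym (+-suc L L))) ⟩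
  ∑ f (suc L + suc L)                              ∎
  where
  open ≡-Reasoning
  odds = ∑ (λ i → f (suc (i + i))) L
  evens = ∑ (λ i → f (i + i)) L
  regroup : ∀ a b c d → (a + b) + (c + d) ≡ (a + c) + d + b
  regroup = solve-∀ℕ

binary-sum : ∀ K x → x < 2 ^ K → ∑ (λ j → 2 ^ (j + bit x j)) K + 1 ≡ 2 ^ K + x
binary-sum zero zero _ = refl
binary-sum zero (suc x) (s≤s ())
binary-sum (suc K) x x< = begin
  ∑ (λ j → 2 ^ (j + bit x j)) (suc K) + 1           ≡⟨ cong (_+ 1) (∑-front (λ j → 2 ^ (j + bit x j)) K) ⟩
  2 ^ (x % 2) + ∑ (λ j → 2 * f j) K + 1            ≡⟨ cong (λ s → 2 ^ (x % 2) + s + 1) (∑-double f K) ⟩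
  2 ^ (x % 2) + 2 * ∑ f K + 1                      ≡⟨ cong (λ p → p + 2 * ∑ f K + 1) (2^bit (x % 2) (m%n<n x 2)) ⟩
  x % 2 + 1 + 2 * ∑ f K + 1                        ≡⟨ regroup₁ (x % 2) (∑ f K) ⟩
  x % 2 + 2 * (∑ f K + 1)                          ≡⟨ cong (λ s → x % 2 + 2 * s) (binary-sum K (x / 2) half<) ⟩
  x % 2 + 2 * (2 ^ K + x / 2)                      ≡⟨ regroup₂ (x % 2) (2 ^ K) (x / 2) ⟩
  2 * 2 ^ K + (x % 2 + x / 2 * 2)                  ≡⟨ cong (λ y → 2 * 2 ^ K + y) (sym (m≡m%n+[m/n]*n x 2)) ⟩
  2 * 2 ^ K + x                                    ∎
  where
  open ≡-Reasoning
  f : ℕ → ℕ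
  f j = 2 ^ (j + bit (x / 2) j)
  2^bit : ∀ b → b < 2 → 2 ^ b ≡ b + 1
  2^bit 0 _ = refl
  2^bit 1 _ = refl
  2^bit (suc (suc b)) (s≤s (s≤s ()))
  regroup₁ : ∀ b s → b + 1 + 2 * s + 1 ≡ b + 2 * (s + 1)
  regroup₁ = solve-∀ℕ
  regroup₂ : ∀ b p q → b + 2 * (p + q) ≡ 2 * p + (b + q * 2)
  regroup₂ = solve-∀ℕ
  half< : x / 2 < 2 ^ K
  half< = m<n*o⇒m/o<n (subst (x <_) (*-comm 2 (2 ^ K)) x<)

DS-concat-map : ∀ (G : ℕ → List ℕ) xs → DS (concat (map G xs)) ≡ sum (map (λ x → DS (G x)) xs)
DS-concat-map G [] = refl
DS-concat-map G (x ∷ xs) = trans (sum-++ (G x) (concat (map G xs))) (cong (λ s → DS (G x) + s) (DS-concat-map G xs))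

sum-map-upTo : ∀ f n → sum (map f (upTo n)) ≡ ∑ f n
sum-map-upTo f zero = refl
sum-map-upTo f (suc n) = begin
  sum (map f (upTo (suc n)))            ≡⟨ cong (λ xs → sum (map f xs)) (sym (upTo-∷ʳ n)) ⟩
  sum (map f (upTo n ++ (n ∷ [])))      ≡⟨ cong sum (map-++ f (upTo n) (n ∷ [])) ⟩
  sum (map f (upTo n) ++ (f n ∷ []))    ≡⟨ sum-++ (map f (upTo n)) (f n ∷ []) ⟩
  sum (map f (upTo n)) + (f n + 0)      ≡⟨ cong₂ _+_ (sum-map-upTo f n) (+-identityʳ (f n)) ⟩
  ∑ f n + f n                           ∎
  where open ≡-Reasoning

-- The digit sums of the blocks of W(n) for remainder r are the values
-- F r j = 2^{(j+1) + m_{j+1}} + 1 with j + 1 the exponent of the block.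
F : ℕ → ℕ → ℕ
F r j = 2 ^ (suc j + bit r (suc j)) + 1

leftBlocks rightBlocks : ℕ → ℕ → List ℕ
leftBlocks r L = concat (map (λ i → blk (2 * i + bit r (2 * i))) (map suc (upTo L)))
rightBlocks r R = concat (map (λ i → blk (2 * i ∸ 1 + bit r (2 * i ∸ 1))) (reverse (map suc (upTo R))))

-- W_L contributes the odd indices j = 2i + 1 < 2L + 1 and W_R the even
-- indices j = 2i < 2R.
DS-leftBlocks : ∀ r L → DS (leftBlocks r L) ≡ ∑ (λ i → F r (suc (i + i))) L
DS-leftBlocks r L = begin
  DS (leftBlocks r L)                                  ≡⟨ DS-concat-map G (map suc (upTo L)) ⟩
  sum (map (λ i → DS (G i)) (map suc (upTo L)))        ≡⟨ cong sum (sym (map-∘ (upTo L))) ⟩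
  sum (map (λ i → DS (G (suc i))) (upTo L))            ≡⟨ sum-map-upTo (λ i → DS (G (suc i))) L ⟩
  ∑ (λ i → DS (G (suc i))) L                           ≡⟨ ∑-cong L (λ i → trans (DS-blk (2 * suc i + bit r (2 * suc i))) (cong (λ e → 2 ^ (e + bit r e) + 1) (2[i+1] i))) ⟩
  ∑ (λ i → F r (suc (i + i))) L                        ∎
  where
  open ≡-Reasoning
  G : ℕ → List ℕ
  G i = blk (2 * i + bit r (2 * i))
  2[i+1] : ∀ i → 2 * suc i ≡ suc (suc (i + i))
  2[i+1] i = cong suc (trans (cong (λ j → i + j) (+-identityʳ (suc i))) (+-suc i i))

DS-rightBlocks : ∀ r R → DS (rightBlocks r R) ≡ ∑ (λ i → F r (i + i)) R
DS-rightBlocks r R = begin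
  DS (rightBlocks r R)                                        ≡⟨ DS-concat-map G (reverse (map suc (upTo R))) ⟩
  sum (map (λ i → DS (G i)) (reverse (map suc (upTo R))))     ≡⟨ cong sum (reverse-map (λ i → DS (G i)) (map suc (upTo R))) ⟩
  sum (reverse (map (λ i → DS (G i)) (map suc (upTo R))))     ≡⟨ sum-↭ (↭-reverse (map (λ i → DS (G i)) (map suc (upTo R)))) ⟩
  sum (map (λ i → DS (G i)) (map suc (upTo R)))               ≡⟨ cong sum (sym (map-∘ (upTo R))) ⟩
  sum (map (λ i → DS (G (suc i))) (upTo R))                   ≡⟨ sum-map-upTo (λ i → DS (G (suc i))) R ⟩
  ∑ (λ i → DS (G (suc i))) R                                  ≡⟨ ∑-cong R (λ i → trans (DS-blk (2 * suc i ∸ 1 + bit r (2 * suc i ∸ 1))) (cong (λ e → 2 ^ (e + bit r e) + 1) (2[i+1]-1 i))) ⟩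
  ∑ (λ i → F r (i + i)) R                                     ∎
  where
  open ≡-Reasoning
  G : ℕ → List ℕ
  G i = blk (2 * i ∸ 1 + bit r (2 * i ∸ 1))
  2[i+1]-1 : ∀ i → 2 * suc i ∸ 1 ≡ suc (i + i)
  2[i+1]-1 i = trans (cong (λ j → i + j) (+-identityʳ (suc i))) (+-suc i i)

bitWord : ℕ → List ℕ
bitWord 0 = []
bitWord _ = 1 ∷ []

W' : ℕ → ℕ → List ℕ
W' k r = (bitWord (bit r 0) ++ (2 ∷ leftBlocks r ((k ∸ 1) / 2))) ++ (rightBlocks r (k / 2) ++ (2 ∷ []))

W-unfold : ∀ n → let k = ⌊log₂ suc (suc n) ⌋ in W (suc (suc n)) ≡ W' k (suc (suc n) ∸ 2 ^ k)
W-unfold n with bit (suc (suc n) ∸ 2 ^ ⌊log₂ suc (suc n) ⌋) 0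
... | zero = refl
... | suc _ = refl

half-even : ∀ L → (L + L) / 2 ≡ L
half-even zero = refl
half-even (suc L) = trans (cong (_/ 2) (cong suc (+-suc L L)))
  (trans (m/n≡1+[m∸n]/n {suc (suc (L + L))} {2} (s≤s (s≤s z≤n))) (cong suc (half-even L)))

half-odd : ∀ L → suc (L + L) / 2 ≡ L
half-odd zero = refl
half-odd (suc L) = trans (cong (_/ 2) (cong suc (cong suc (+-suc L L))))
  (trans (m/n≡1+[m∸n]/n {suc (suc (suc (L + L)))} {2} (s≤s (s≤s z≤n))) (cong suc (half-odd L)))

DS-blocks : ∀ r k' → DS (leftBlocks r (k' / 2)) + DS (rightBlocks r (suc k' / 2)) ≡ ∑ (F r) k'
DS-blocks r k' with parity k'
... | even L = begin
  DS (leftBlocks r ((L + L) / 2)) + DS (rightBlocks r (suc (L + L) / 2))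
    ≡⟨ cong₂ (λ x y → DS (leftBlocks r x) + DS (rightBlocks r y)) (half-even L) (half-odd L) ⟩
  DS (leftBlocks r L) + DS (rightBlocks r L)
    ≡⟨ cong₂ _+_ (DS-leftBlocks r L) (DS-rightBlocks r L) ⟩
  ∑ (λ i → F r (suc (i + i))) L + ∑ (λ i → F r (i + i)) L
    ≡⟨ ∑-interleave (F r) L ⟩
  ∑ (F r) (L + L) ∎
  where open ≡-Reasoning
... | odd L = begin
  DS (leftBlocks r (suc (L + L) / 2)) + DS (rightBlocks r (suc (suc (L + L)) / 2))
    ≡⟨ cong₂ (λ x y → DS (leftBlocks r x) + DS (rightBlocks r y)) (half-odd L) half-next ⟩
  DS (leftBlocks r L) + DS (rightBlocks r (suc L))
    ≡⟨ cong₂ _+_ (DS-leftBlocks r L) (DS-rightBlocks r (suc L)) ⟩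
  ∑ (λ i → F r (suc (i + i))) L + (∑ (λ i → F r (i + i)) L + F r (L + L))
    ≡⟨ sym (+-assoc (∑ (λ i → F r (suc (i + i))) L) _ _) ⟩
  ∑ (λ i → F r (suc (i + i))) L + ∑ (λ i → F r (i + i)) L + F r (L + L)
    ≡⟨ cong (_+ F r (L + L)) (∑-interleave (F r) L) ⟩
  ∑ (F r) (suc (L + L)) ∎
  where
  open ≡-Reasoning
  half-next : suc (suc (L + L)) / 2 ≡ suc L
  half-next = trans (cong (λ x → suc x / 2) (sym (+-suc L L))) (half-even (suc L))

DS-W' : ∀ k' r → r < 2 ^ suc k' → DS (W' (suc k') r) ≡ 2 ^ suc k' + r + suc k' + 1
DS-W' k' r r< = begin
  DS (W' (suc k') r)                                         ≡⟨ sum-++ (bitWord (r % 2) ++ (2 ∷ left)) (right ++ (2 ∷ [])) ⟩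
  DS (bitWord (r % 2) ++ (2 ∷ left)) + DS (right ++ (2 ∷ []))
                                                             ≡⟨ cong₂ _+_ (sum-++ (bitWord (r % 2)) (2 ∷ left)) (sum-++ right (2 ∷ [])) ⟩
  (DS (bitWord (r % 2)) + (2 + DS left)) + (DS right + (2 + 0))
                                                             ≡⟨ cong (λ b → (b + (2 + DS left)) + (DS right + (2 + 0))) (DS-bitWord (r % 2) (m%n<n r 2)) ⟩
  (r % 2 + (2 + DS left)) + (DS right + (2 + 0))             ≡⟨ regroup₁ (r % 2) (DS left) (DS right) ⟩
  r % 2 + (DS left + DS right) + 4                           ≡⟨ cong (λ s → r % 2 + s + 4) (trans (DS-blocks r k') (∑-double+1 f k')) ⟩
  r % 2 + (2 * ∑ f k' + k') + 4                              ≡⟨ regroup₂ (r % 2) (∑ f k') k' ⟩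
  r % 2 + 2 * (∑ f k' + 1) + k' + 2                          ≡⟨ cong (λ s → r % 2 + 2 * s + k' + 2) (binary-sum k' (r / 2) half<) ⟩
  r % 2 + 2 * (2 ^ k' + r / 2) + k' + 2                      ≡⟨ regroup₃ (r % 2) (2 ^ k') (r / 2) k' ⟩
  2 * 2 ^ k' + (r % 2 + r / 2 * 2) + suc k' + 1              ≡⟨ cong (λ x → 2 * 2 ^ k' + x + suc k' + 1) (sym (m≡m%n+[m/n]*n r 2)) ⟩
  2 ^ suc k' + r + suc k' + 1                                ∎
  where
  open ≡-Reasoning
  left = leftBlocks r (k' / 2)
  right = rightBlocks r (suc k' / 2)
  f : ℕ → ℕ
  f j = 2 ^ (j + bit (r / 2) j)
  DS-bitWord : ∀ b → b < 2 → DS (bitWord b) ≡ b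
  DS-bitWord 0 _ = refl
  DS-bitWord 1 _ = refl
  DS-bitWord (suc (suc b)) (s≤s (s≤s ()))
  half< : r / 2 < 2 ^ k'
  half< = m<n*o⇒m/o<n (subst (r <_) (*-comm 2 (2 ^ k')) r<)
  regroup₁ : ∀ b x y → (b + (2 + x)) + (y + (2 + 0)) ≡ b + (x + y) + 4
  regroup₁ = solve-∀ℕ
  regroup₂ : ∀ b s k → b + (2 * s + k) + 4 ≡ b + 2 * (s + 1) + k + 2
  regroup₂ = solve-∀ℕ
  regroup₃ : ∀ b p q k → b + 2 * (p + q) + k + 2 ≡ 2 * p + (b + q * 2) + suc k + 1
  regroup₃ = solve-∀ℕ

level-half : ∀ n k → Level n (suc k) → Level ⌊ n /2⌋ k
level-half n k lv with parity n
... | even m with level-even m (suc k) lv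
...   | _ , refl , lvm = subst (λ x → Level x k) (sym (⌊m+m/2⌋ m)) lvm
  where
  ⌊m+m/2⌋ : ∀ m → ⌊ m + m /2⌋ ≡ m
  ⌊m+m/2⌋ zero = refl
  ⌊m+m/2⌋ (suc m) = trans (cong ⌊_/2⌋ (cong suc (+-suc m m))) (cong suc (⌊m+m/2⌋ m))
level-half _ k lv | odd m = subst (λ x → Level x k) (sym (⌊1+m+m/2⌋ m)) (level-odd m k lv)
  where
  ⌊1+m+m/2⌋ : ∀ m → ⌊ suc (m + m) /2⌋ ≡ m
  ⌊1+m+m/2⌋ zero = refl
  ⌊1+m+m/2⌋ (suc m) = trans (cong ⌊_/2⌋ (cong suc (cong suc (+-suc m m)))) (cong suc (⌊1+m+m/2⌋ m))

level-log : ∀ n k → Level n k → ⌊log₂ n ⌋ ≡ k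
level-log n zero lv rewrite level-1 n lv = refl
level-log n (suc k) lv = begin
  ⌊log₂ n ⌋                ≡⟨ sym (suc-pred ⌊log₂ n ⌋ {{>-nonZero (⌊log₂⌋-mono-≤ {2} {n} 2≤n)}}) ⟩
  suc (⌊log₂ n ⌋ ∸ 1)      ≡⟨ cong suc (sym (⌊log₂⌊n/2⌋⌋≡⌊log₂n⌋∸1 n)) ⟩
  suc ⌊log₂ ⌊ n /2⌋ ⌋      ≡⟨ cong suc (level-log ⌊ n /2⌋ k (level-half n k lv)) ⟩
  suc k                    ∎
  where
  open ≡-Reasoning
  2≤n : 2 ≤ n
  2≤n = ≤-trans (subst (2 ≤_) (sym (2^-suc k)) (+-mono-≤ (1≤2^ k) (1≤2^ k))) (proj₁ lv)

DS-W : ∀ n k → Level n k → DS (W n) ≡ n + k + 1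
DS-W zero k (2^k≤0 , _) = contradiction 2^k≤0 (<⇒≱ (1≤2^ k))
DS-W (suc zero) zero lv = refl
DS-W (suc zero) (suc k) lv = contradiction (level-log 1 (suc k) lv) λ ()
DS-W n@(suc (suc n-2)) zero lv = contradiction (level-1 n lv) λ ()
DS-W n@(suc (suc n-2)) (suc k) lv@(2^k≤n , n<2^k+1) = begin
  DS (W n)                            ≡⟨ cong DS (W-unfold n-2) ⟩
  DS (W' ⌊log₂ n ⌋ (n ∸ 2 ^ ⌊log₂ n ⌋)) ≡⟨ cong (λ e → DS (W' e (n ∸ 2 ^ e))) (level-log n (suc k) lv) ⟩
  DS (W' (suc k) (n ∸ 2 ^ suc k))     ≡⟨ DS-W' k (n ∸ 2 ^ suc k) r< ⟩
  2 ^ suc k + (n ∸ 2 ^ suc k) + suc k + 1 ≡⟨ cong (λ x → x + suc k + 1) (m+[n∸m]≡n 2^k≤n) ⟩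
  n + suc k + 1                       ∎
  where
  open ≡-Reasoning
  r< : n ∸ 2 ^ suc k < 2 ^ suc k
  r< = +-cancelˡ-< (2 ^ suc k) _ _
         (subst (_< 2 ^ suc k + 2 ^ suc k) (sym (m+[n∸m]≡n 2^k≤n)) (subst (n <_) (2^-suc (suc k)) n<2^k+1))

prefix : ℕ → ℕ
prefix zero = 0
prefix (suc N) = prefix N + t N

prefix-window : ∀ n a → prefix a + g n a ≡ prefix (a + n)
prefix-window zero a = trans (+-identityʳ (prefix a)) (cong prefix (sym (+-identityʳ a)))
prefix-window (suc n) a = begin
  prefix a + (t a + g n (suc a))   ≡⟨ sym (+-assoc (prefix a) (t a) _) ⟩
  prefix (suc a) + g n (suc a)     ≡⟨ prefix-window n (suc a) ⟩
  prefix (suc a + n)               ≡⟨ cong prefix (sym (+-suc a n)) ⟩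
  prefix (a + suc n)               ∎
  where open ≡-Reasoning

P0-prefix : ∀ N → P 0 N ≡ + prefix N -ᶻ + N
P0-prefix zero = refl
P0-prefix (suc N) = begin
  P 0 N +ᶻ h (t N)                         ≡⟨ cong₂ _+ᶻ_ (P0-prefix N) (h-letter (t N) (t≤2 N)) ⟩
  (+ prefix N -ᶻ + N) +ᶻ (+ t N -ᶻ + 1)    ≡⟨ regroup (+ prefix N) (+ N) (+ t N) ⟩
  (+ prefix N +ᶻ + t N) -ᶻ (+ 1 +ᶻ + N)    ≡⟨ cong₂ _-ᶻ_ (sym (ℤ.pos-+ (prefix N) (t N))) (sym (ℤ.pos-+ 1 N)) ⟩
  + prefix (suc N) -ᶻ + suc N              ∎
  where
  open ≡-Reasoning
  regroup : ∀ s n x → (s -ᶻ n) +ᶻ (x -ᶻ + 1) ≡ (s +ᶻ x) -ᶻ (+ 1 +ᶻ n)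
  regroup = solve-∀

V-g : ∀ n a → V 0 a n ≡ + g n a -ᶻ + n
V-g n a = begin
  P 0 (a + n) -ᶻ P 0 a                                           ≡⟨ cong₂ _-ᶻ_ (P0-prefix (a + n)) (P0-prefix a) ⟩
  (+ prefix (a + n) -ᶻ + (a + n)) -ᶻ (+ prefix a -ᶻ + a)         ≡⟨ cong (λ x → (+ x -ᶻ + (a + n)) -ᶻ (+ prefix a -ᶻ + a)) (sym (prefix-window n a)) ⟩
  (+ (prefix a + g n a) -ᶻ + (a + n)) -ᶻ (+ prefix a -ᶻ + a)     ≡⟨ cong₂ (λ x y → (x -ᶻ y) -ᶻ (+ prefix a -ᶻ + a)) (ℤ.pos-+ (prefix a) (g n a)) (ℤ.pos-+ a n) ⟩
  ((+ prefix a +ᶻ + g n a) -ᶻ (+ a +ᶻ + n)) -ᶻ (+ prefix a -ᶻ + a) ≡⟨ regroup (+ prefix a) (+ g n a) (+ a) (+ n) ⟩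
  + g n a -ᶻ + n                                                  ∎
  where
  open ≡-Reasoning
  regroup : ∀ s x a n → ((s +ᶻ x) -ᶻ (a +ᶻ n)) -ᶻ (s -ᶻ a) ≡ x -ᶻ n
  regroup = solve-∀

-- The upper tables are non-positive, so |window| + ⌊log₂ n⌋ + 1 bounds g.
hi≤0 : ∀ κ p q → p ≤ 2 → q ≤ 2 → hi κ p q ≤ᶻ + 0
hi≤0 κ p q p≤2 q≤2 = ℤ.≤ᵇ⇒≤ (allPairs-sound (λ p q → hi κ p q ≤ᵇᶻ + 0) (checked κ) p q p≤2 q≤2)
  where
  checked : ∀ κ → T (allPairs (λ p q → hi κ p q ≤ᵇᶻ + 0))
  checked κ1 = tt
  checked κpow = tt
  checked κeven = tt
  checked κodd = tt

g-upper : ∀ n k → Level n k → ∀ a → g n a ≤ n + k + 1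
g-upper n k lv a = subst (g n a ≤_) (+-suc-assoc n k) (ℤ.drop‿+≤+ (begin
  + g n a                                  ≡⟨ regroup (+ g n a) (+ n) (radius k) ⟩
  V' -ᶻ radius k +ᶻ (+ n +ᶻ radius k)      ≤⟨ ℤ.+-monoˡ-≤ (+ n +ᶻ radius k) V'-bound ⟩
  + 0 +ᶻ (+ n +ᶻ radius k)                 ≡⟨ sym (ℤ.pos-+ n (suc k)) ⟩
  + (n + suc k)                            ∎))
  where
  open ℤ.≤-Reasoning
  V' = + g n a -ᶻ + n
  V'-bound : V' -ᶻ radius k ≤ᶻ + 0
  V'-bound = subst (λ v → v -ᶻ radius k ≤ᶻ + 0) (V-g n a)
    (ℤ.≤-trans (proj₂ (bounded n k lv 0 a)) (hi≤0 (class n k) _ _ (τ≤2 0 a) (τ≤2 0 (a + n))))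
  regroup : ∀ x n r → x ≡ (x -ᶻ n) -ᶻ r +ᶻ (n +ᶻ r)
  regroup = solve-∀
  +-suc-assoc : ∀ n k → n + suc k ≡ n + k + 1
  +-suc-assoc n k = trans (cong (λ x → n + x) (+-comm 1 k)) (sym (+-assoc n k 1))

-- The bound n + ⌊log₂ n⌋ + 1 is attained by windows beyond every position:
-- the first configuration of every class has centred sum exactly k + 1.
peak-config : ∀ κ → Σ Config λ x → x ∈ configs κ × positive x ≡ true × offset x ≡ + 0
peak-config κ1 = _ , here refl , refl , refl
peak-config κpow = _ , here refl , refl , refl
peak-config κeven = _ , here refl , refl , refl
peak-config κodd = _ , here refl , refl , refl

g-peak : ∀ n k → Level n k → ∀ N → Σ ℕ λ a → N ≤ a × g n a ≡ n + k + 1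
g-peak n k lv N = a , N≤a , ℤ.+-injective (begin
  + g n a                              ≡⟨ regroup (+ g n a) (+ n) ⟩
  + n +ᶻ (+ g n a -ᶻ + n)              ≡⟨ cong (λ v → + n +ᶻ v) (trans (sym (V-g n a)) value) ⟩
  + n +ᶻ (signed (positive x) (radius k) +ᶻ offset x)
                                       ≡⟨ cong₂ (λ s o → + n +ᶻ (signed s (radius k) +ᶻ o)) positive≡ offset≡ ⟩
  + n +ᶻ (+ suc k +ᶻ + 0)              ≡⟨ cong (λ v → + n +ᶻ v) (ℤ.+-identityʳ (+ suc k)) ⟩
  + n +ᶻ + suc k                       ≡⟨ sym (ℤ.pos-+ n (suc k)) ⟩
  + (n + suc k)                        ≡⟨ cong +_ (trans (cong (λ y → n + y) (+-comm 1 k)) (sym (+-assoc n k 1))) ⟩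
  + (n + k + 1)                        ∎)
  where
  peak = peak-config (class n k)
  x = proj₁ peak
  positive≡ = proj₁ (proj₂ (proj₂ peak))
  offset≡ = proj₂ (proj₂ (proj₂ peak))
  realised = realisable n k lv x (proj₁ (proj₂ peak)) 0 N
  a = proj₁ realised
  N≤a = proj₁ (proj₂ realised)
  value : V 0 a n ≡ signed (positive x) (radius k) +ᶻ offset x
  value = proj₂ (proj₂ (proj₂ (proj₂ realised)))
  open ≡-Reasoning
  regroup : ∀ x n → x ≡ n +ᶻ (x -ᶻ n)
  regroup = solve-∀

-- Sliding a window by one position drops one letter and gains one letter ≤ 2.
g-step : ∀ n j → g n (suc j) ≤ g n j + 2
g-step n j = ≤-trans (m≤n+m (g n (suc j)) (t j)) (≤-trans (≤-reflexive slide) (+-monoʳ-≤ (g n j) (t≤2 (j + n))))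
  where
  open ≡-Reasoning
  slide : t j + g n (suc j) ≡ g n j + t (j + n)
  slide = +-cancelˡ-≡ (prefix j) _ _ (begin
    prefix j + (t j + g n (suc j))   ≡⟨ sym (+-assoc (prefix j) (t j) _) ⟩
    prefix (suc j) + g n (suc j)     ≡⟨ prefix-window n (suc j) ⟩
    prefix (j + n) + t (j + n)       ≡⟨ cong (_+ t (j + n)) (sym (prefix-window n j)) ⟩
    prefix j + g n j + t (j + n)     ≡⟨ +-assoc (prefix j) (g n j) _ ⟩
    prefix j + (g n j + t (j + n))   ∎)

first-exceed : ∀ (f : ℕ → ℕ) s i j → i < j → s < f j →
  Σ ℕ λ r → i < r × s < f r × (∀ j' → i < j' → j' < r → f j' ≤ s)
first-exceed f s i j i<j s<fj = scan (suc i) (j ∸ suc i) (n<1+n i) (λ j' i<j' j'<1+i → contradiction (≤-pred j'<1+i) (<⇒≱ i<j'))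
                                     (subst (λ x → s < f x) (sym (m+[n∸m]≡n i<j)) s<fj)
  where
  scan : ∀ j' d → i < j' → (∀ j'' → i < j'' → j'' < j' → f j'' ≤ s) → s < f (j' + d) →
         Σ ℕ λ r → i < r × s < f r × (∀ j'' → i < j'' → j'' < r → f j'' ≤ s)
  scan j' d i<j' below s<f with s <? f j'
  ... | yes s<fj' = j' , i<j' , s<fj' , below
  ... | no s≮fj' with d
  ...   | zero = contradiction (subst (λ x → s < f x) (+-identityʳ j') s<f) s≮fj'
  ...   | suc d' = scan (suc j') d' (m≤n⇒m≤1+n i<j') below' (subst (λ x → s < f x) (+-suc j' d') s<f)
    where
    below' : ∀ j'' → i < j'' → j'' < suc j' → f j'' ≤ s
    below' j'' i<j'' j''<1+j' with m≤n⇒m<n∨m≡n (≤-pred j''<1+j')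
    ... | inj₁ j''<j' = below j'' i<j'' j''<j'
    ... | inj₂ refl = ≮⇒≥ s≮fj'

overshoot : ∀ (f : ℕ → ℕ) s j → (∀ j → f (suc j) ≤ f j + 2) → f j ≤ s → s < f (suc j) →
  ((f (suc j) ≡ s + 1) ⊎ (f (suc j) ≡ s + 2)) × (f (suc j) ≡ s + 2 → f j ≡ s)
overshoot f s j step fj≤s s<f = one-or-two , from-s
  where
  f≤s+2 : f (suc j) ≤ s + 2
  f≤s+2 = ≤-trans (step j) (+-monoˡ-≤ 2 fj≤s)
  one-or-two : (f (suc j) ≡ s + 1) ⊎ (f (suc j) ≡ s + 2)
  one-or-two with m≤n⇒m<n∨m≡n f≤s+2
  ... | inj₂ e = inj₂ e
  ... | inj₁ f<s+2 = inj₁ (≤-antisym (subst (f (suc j) ≤_) (+-comm 1 s) (≤-pred (subst (f (suc j) <_) (+-comm s 2) f<s+2)))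
                                     (subst (_≤ f (suc j)) (+-comm 1 s) s<f))
  from-s : f (suc j) ≡ s + 2 → f j ≡ s
  from-s e = ≤-antisym fj≤s (+-cancelʳ-≤ 2 _ _ (subst (_≤ f j + 2) e (step j)))

first-passage : ∀ (f : ℕ → ℕ) s i j → (∀ j → f (suc j) ≤ f j + 2) → f i ≡ s → i < j → s < f j →
  Σ ℕ λ r → i < r × s < f r × (∀ j' → i < j' → j' < r → f j' ≤ s) ×
            ((f r ≡ s + 1) ⊎ (f r ≡ s + 2)) × (f r ≡ s + 2 → f (r ∸ 1) ≡ s)
first-passage f s i j step fi≡s i<j s<fj with first-exceed f s i j i<j s<fj
... | suc r , i<r+1 , s<f , below = suc r , i<r+1 , s<f , below , overshoot f s r step previous s<f
  where
  previous : f r ≤ s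
  previous with m≤n⇒m<n∨m≡n (≤-pred i<r+1)
  ... | inj₁ i<r = below r i<r (n<1+n r)
  ... | inj₂ refl = ≤-reflexive fi≡s

lemma7 : (n : ℕ) → n ≥ 1 → (u : List ℕ) → length u ≡ n → (∃ λ i₀ → factor i₀ n ≡ u) →
           DS u ≢ DS (W n) →
           (i : ℕ) → factor i n ≡ u →
           ∃ λ r → (i < r) × (DS u < g n r) × (∀ j → i < j → j < r → g n j ≤ DS u) ×
                   ((g n r ≡ DS u + 1) ⊎ (g n r ≡ DS u + 2)) ×
                   (g n r ≡ DS u + 2 → g n (r ∸ 1) ≡ DS u)
lemma7 n n≥1 u _ _ DSu≢DSW i factor≡u =
  first-passage (g n) (DS u) i a (g-step n) gi≡DSu i<a (subst (DS u <_) (sym ga≡peak) DSu<peak)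
  where
  level = level-exists n n≥1
  k = proj₁ level
  lv = proj₂ level
  peak = g-peak n k lv (suc i)
  a = proj₁ peak
  i<a = proj₁ (proj₂ peak)
  ga≡peak = proj₂ (proj₂ peak)
  gi≡DSu : g n i ≡ DS u
  gi≡DSu = cong DS factor≡u
  DSu<peak : DS u < n + k + 1
  DSu<peak = ≤∧≢⇒< (subst (_≤ n + k + 1) gi≡DSu (g-upper n k lv i)) (λ e → DSu≢DSW (trans e (sym (DS-W n k lv))))
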